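{- For every integer $n\geq 1$, the number of Fishburn permutations of length $n$ that avoid both classical patterns $321$ and $21354$ equals $2^n-\binom{n}{2}-1$.
   Context: A permutation of length $n$ is a rearrangement $\pi=\pi_1\cdots\pi_n$ of $[n]$. A permutation $\pi$ contains a classical pattern $p\in S_k$ if some subsequence of $\pi$ of length $k$ is order-isomorphic to $p$; otherwise it avoids $p$. A Fishburn permutation is a permutation $\pi$ for which there are no indices $i<j$ with $\pi_j<\pi_i<\pi_{i+1}$ and $\pi_i=\pi_j+1$. -}

module Defs where

open import Data.Bool using (Bool; true; false; _∧_; _∨_; not)
open import Data.Nat using (ℕ; zero; suc; _≡ᵇ_; _<ᵇ_; _+_)
open import Data.List using (List; []; _∷_; map; concatMap; filterᵇ; length; zip; applyUpTo)
open import Data.Bool.ListAction using (all; any)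
open import Data.Product using (_×_; _,_)

words : ℕ → List ℕ → List (List ℕ)
words zero    xs = [] ∷ []
words (suc k) xs = concatMap (λ x → map (x ∷_) (words k xs)) xs

distinct : List ℕ → Bool
distinct []       = true
distinct (x ∷ xs) = all (λ y → not (x ≡ᵇ y)) xs ∧ distinct xs

range1 : ℕ → List ℕ
range1 n = applyUpTo suc n

-- The permutations of length n, as one-line notations π₁⋯πₙ of [n]:
-- words of length n over [n] with no repeated entry (each appears once).
perms : ℕ → List (List ℕ)
perms n = filterᵇ distinct (words n (range1 n))

subseqs : ℕ → List ℕ → List (List ℕ)
subseqs zero    _        = [] ∷ []
subseqs (suc k) []       = []
subseqs (suc k) (x ∷ xs) = map (x ∷_) (subseqs k xs) ++' subseqs (suc k) xs
  where
  _++'_ : List (List ℕ) → List (List ℕ) → List (List ℕ)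
  [] ++' ys = ys
  (a ∷ as) ++' ys = a ∷ (as ++' ys)

pairs : List (ℕ × ℕ) → List ((ℕ × ℕ) × (ℕ × ℕ))
pairs xs = concatMap (λ a → map (a ,_) xs) xs

eqLen : List ℕ → List ℕ → Bool
eqLen []       []       = true
eqLen (_ ∷ as) (_ ∷ bs) = eqLen as bs
eqLen _        _        = false

orderIso : List ℕ → List ℕ → Bool
orderIso p s = eqLen p s ∧
  all (λ { ((a , c) , (b , d)) → eqB (a <ᵇ b) (c <ᵇ d) }) (pairs (zip p s))
  where
  eqB : Bool → Bool → Bool
  eqB true  y = y
  eqB false y = not y

contains : List ℕ → List ℕ → Bool
contains p π = any (orderIso p) (subseqs (length p) π)

avoids : List ℕ → List ℕ → Bool
avoids p π = not (contains p π)

-- π has indices i < j with π_j < π_i < π_{i+1} and π_i = π_j + 1.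
-- (For each i, we test π_i < π_{i+1} and look for j > i with π_i = π_j + 1;
--  π_j < π_i then holds automatically.)
fishburnBad : List ℕ → Bool
fishburnBad (x ∷ y ∷ rest) =
  ((x <ᵇ y) ∧ any (λ z → x ≡ᵇ (z + 1)) (y ∷ rest)) ∨ fishburnBad (y ∷ rest)
fishburnBad _ = false

isFishburn : List ℕ → Bool
isFishburn π = not (fishburnBad π)

p321 : List ℕ
p321 = 3 ∷ 2 ∷ 1 ∷ []

p21354 : List ℕ
p21354 = 2 ∷ 1 ∷ 3 ∷ 5 ∷ 4 ∷ []

F : ℕ → List (List ℕ)
F n = filterᵇ (λ π → isFishburn π ∧ avoids p321 π ∧ avoids p21354 π) (perms n)

-- A good permutation (Fishburn, avoiding 321 and 21354) of the values a < z ≤ t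
-- either starts with a + 1, followed by a good permutation of a + 1 < z ≤ t, or
-- starts with some k > a + 1.  In the latter case k is followed by the run
-- a + 1, a + 2, …: a value above k in second place breaks the Fishburn
-- condition at k (as k − 1 comes later), and any other value below k forms 321
-- with k and a + 1.  The run either reaches k − 1 with nothing left (k = t), or
-- it is interrupted by a jump to some m > k.  After the jump the remaining values
-- below k, those between k and m, and those above m each appear in increasing
-- order (else 321 with k or with m, or 21354 with k, a + 1 and m, appears), and
-- they interleave freely except that the values between k and m come after all
-- values below k, and a value above m neither comes inside that block nor
-- directly after m unless the block is empty.  Conversely every such
-- arrangement is good.  Listing the arrangements without repetition and
-- counting them with Pascal's rule and the row sums of binomial coefficients
-- shows that 2^(n−1) − (n − 1) good permutations of n values start above their
-- least value, and the formula follows by induction on n.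

module Submission where

open import Data.Bool using (Bool; true; false; T; T?; not; _∧_; if_then_else_)
open import Data.Bool.ListAction using (all; any)
open import Data.Bool.Properties using (T-∧; T-∨)
open import Data.Empty using (⊥; ⊥-elim)
open import Data.List using (List; []; _∷_; [_]; map; _++_; length; zip; concatMap)
open import Data.List.Membership.Propositional using (_∈_; _∉_; find; lose)
open import Data.List.Membership.Propositional.Properties
  using (∈-map⁺; ∈-map⁻; ∈-++⁺ˡ; ∈-++⁺ʳ; ∈-++⁻; ∈-∃++; ∈-concatMap⁺; ∈-concatMap⁻;
         ∈-applyUpTo⁺; ∈-applyUpTo⁻; ∈-filter⁺; ∈-filter⁻)
open import Data.List.Membership.Propositional.Properties.WithK using (unique∧set⇒bag)
open import Data.List.Properties using (length-++; length-map; length-applyUpTo; ∷-injectiveʳ)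
open import Data.List.Relation.Binary.BagAndSetEquality using (∼bag⇒↭)
open import Data.List.Relation.Binary.Disjoint.Propositional using (Disjoint)
open import Data.List.Relation.Binary.Permutation.Propositional.Properties using (↭-length)
open import Data.List.Relation.Binary.Sublist.Propositional
  using (_⊆_; []; _∷_; _∷ʳ_; minimum; to∈; from∈; ⊆-refl; ⊆-trans)
open import Data.List.Relation.Binary.Sublist.Propositional.Properties using (∷ˡ⁻)
open import Data.List.Relation.Unary.All using (All; []; _∷_)
import Data.List.Relation.Unary.All as All
open import Data.List.Relation.Unary.All.Properties using (all⁺; all⁻)
open import Data.List.Relation.Unary.AllPairs using ([]; _∷_)
open import Data.List.Relation.Unary.Any using (here; there)
open import Data.List.Relation.Unary.Any.Properties using (any⁺; any⁻)
open import Data.List.Relation.Unary.Unique.Propositional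
  using (Unique) renaming (head to Unique-head; tail to Unique-tail)
open import Data.List.Relation.Unary.Unique.Propositional.Properties using (++⁺; map⁺; filter⁺; applyUpTo⁺₁)
open import Data.Nat using (ℕ; zero; suc; _+_; _∸_; _^_; _<_; _≤_; _≥_; _<ᵇ_; _≡ᵇ_; z≤n; s≤s; _≟_)
open import Data.Nat.Combinatorics using (_C_; nCk+nC[k+1]≡[n+1]C[k+1])
open import Data.Nat.Properties
open import Data.List.Membership.DecPropositional _≟_ using (_∈?_)
open import Data.Nat.Solver using (module +-*-Solver)
open +-*-Solver using (solve; _:+_; _:=_; con)
open import Algebra.Properties.CommutativeSemigroup +-commutativeSemigroup using (interchange; x∙yz≈y∙xz)
open import Data.Product using (∃; ∃₂; ∃-syntax; _×_; _,_; proj₁; proj₂; swap)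
open import Data.Sum using (_⊎_; inj₁; inj₂)
open import Data.Unit using (⊤; tt)
open import Function using (_∘_; _⇔_; mk⇔; Equivalence)
open import Relation.Binary.Definitions using (tri<; tri≈; tri>)
open import Relation.Binary.PropositionalEquality hiding ([_])
open ≡-Reasoning
open import Relation.Nullary using (¬_; Dec; yes; no; contradiction)
open import Relation.Nullary.Decidable using (_⊎-dec_)
open import Relation.Nullary.Reflects using (ofʸ; ofⁿ)

open import Defs

unique∧set⇒length≡ : {A : Set} {xs ys : List A} → Unique xs → Unique ys →
  (∀ {z} → z ∈ xs → z ∈ ys) → (∀ {z} → z ∈ ys → z ∈ xs) → length xs ≡ length ys
unique∧set⇒length≡ ux uy to from = ↭-length (∼bag⇒↭ (unique∧set⇒bag ux uy (mk⇔ to from)))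

-- subseqs appends with a local copy of _++_ that cannot be named; it agrees
-- with _++_ because it satisfies the same defining equations, and after
-- generalising its arguments the type of subseqs-appended is found by unification.
appendLike≡++ : {X : Set} {op : List X → List X → List X} →
  (∀ B → op [] B ≡ B) → (∀ a A B → op (a ∷ A) B ≡ a ∷ op A B) → ∀ A B → op A B ≡ A ++ B
appendLike≡++ nil cons []      B = nil B
appendLike≡++ nil cons (a ∷ A) B = trans (cons a A B) (cong (a ∷_) (appendLike≡++ nil cons A B))

mutual
  subseqs-appended : ∀ (k x : ℕ) (xs : List ℕ) (A B : List (List ℕ)) → _ ≡ A ++ B
  subseqs-appended k x xs = appendLike≡++ (λ _ → refl) (λ _ _ _ → refl)

  subseqs-∷ : ∀ k x xs → subseqs (suc k) (x ∷ xs) ≡ map (x ∷_) (subseqs k xs) ++ subseqs (suc k) xs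
  subseqs-∷ k x xs with map {A = List ℕ} {B = List ℕ} (_∷_ x) (subseqs k xs) | subseqs (suc k) xs
  ... | A | B = subseqs-appended k x xs A B

∈-subseqs⁻ : ∀ k xs {s} → s ∈ subseqs k xs → s ⊆ xs
∈-subseqs⁻ zero    xs       (here refl) = minimum xs
∈-subseqs⁻ (suc k) (x ∷ xs) s∈ rewrite subseqs-∷ k x xs with ∈-++⁻ (map (x ∷_) (subseqs k xs)) s∈
... | inj₁ s∈ˡ with ∈-map⁻ (x ∷_) s∈ˡ
...   | t , t∈ , refl = refl ∷ ∈-subseqs⁻ k xs t∈
∈-subseqs⁻ (suc k) (x ∷ xs) s∈ | inj₂ s∈ʳ = x ∷ʳ ∈-subseqs⁻ (suc k) xs s∈ʳ

∈-subseqs⁺ : ∀ {s xs} → s ⊆ xs → s ∈ subseqs (length s) xs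
∈-subseqs⁺ []                         = here refl
∈-subseqs⁺ {[]}            (y ∷ʳ _)   = here refl
∈-subseqs⁺ {x ∷ s} {y ∷ ys} (y ∷ʳ σ)  =
  subst (x ∷ s ∈_) (sym (subseqs-∷ (length s) y ys)) (∈-++⁺ʳ (map (y ∷_) (subseqs (length s) ys)) (∈-subseqs⁺ σ))
∈-subseqs⁺ {x ∷ s} {x ∷ ys} (refl ∷ σ) =
  subst (x ∷ s ∈_) (sym (subseqs-∷ (length s) x ys)) (∈-++⁺ˡ (∈-map⁺ (x ∷_) (∈-subseqs⁺ σ)))

eqLen⇒length≡ : ∀ p s → T (eqLen p s) → length s ≡ length p
eqLen⇒length≡ []      []      _ = refl
eqLen⇒length≡ (_ ∷ p) (_ ∷ s) e = cong suc (eqLen⇒length≡ p s e)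

contains⁻ : ∀ p π → T (contains p π) → ∃[ s ] s ⊆ π × T (orderIso p s)
contains⁻ p π c with find (any⁻ (orderIso p) (subseqs (length p) π) c)
... | s , s∈ , iso = s , ∈-subseqs⁻ (length p) π s∈ , iso

contains⁺ : ∀ p {π s} → s ⊆ π → T (orderIso p s) → T (contains p π)
contains⁺ p {π} {s} σ iso = any⁺ (orderIso p) (lose s∈ iso)
  where
  s∈ : s ∈ subseqs (length p) π
  s∈ = subst (λ n → s ∈ subseqs n π) (eqLen⇒length≡ p s (proj₁ (Equivalence.to T-∧ iso))) (∈-subseqs⁺ σ)

∈-pairs⁺ : ∀ {a b : ℕ × ℕ} {xs} → a ∈ xs → b ∈ xs → (a , b) ∈ pairs xs
∈-pairs⁺ {xs = xs} a∈ b∈ = ∈-concatMap⁺ (λ a → map (a ,_) xs) {xs = xs} (lose a∈ (∈-map⁺ (_ ,_) b∈))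

∈-pairs⁻ : ∀ {a b : ℕ × ℕ} {xs} → (a , b) ∈ pairs xs → a ∈ xs × b ∈ xs
∈-pairs⁻ {xs = xs} ab∈ with find (∈-concatMap⁻ (λ a → map (a ,_) xs) {xs = xs} ab∈)
... | a , a∈ , ab∈′ with ∈-map⁻ (a ,_) ab∈′
...   | b , b∈ , refl = a∈ , b∈

<ᵇ-cong : ∀ {x y u v} → (x < y → u < v) → (u < v → x < y) → (x <ᵇ y) ≡ (u <ᵇ v)
<ᵇ-cong {x} {y} {u} {v} to from with x <ᵇ y | <ᵇ-reflects-< x y | u <ᵇ v | <ᵇ-reflects-< u v
... | true  | _       | true  | _       = refl
... | false | _       | false | _       = refl
... | true  | ofʸ x<y | false | ofⁿ u≮v = contradiction (to x<y) u≮v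
... | false | ofⁿ x≮y | true  | ofʸ u<v = contradiction (from u<v) x≮y

-- orderIso compares pairs with a helper local to Defs, which cannot be referred
-- to; sameOrder is a copy of it.  For a concrete pattern p and a list s of the
-- same length, orderIso′ p s and orderIso p s compute to the same Boolean.
sameOrder : (ℕ × ℕ) × (ℕ × ℕ) → Bool
sameOrder ((a , c) , (b , d)) = if a <ᵇ b then c <ᵇ d else not (c <ᵇ d)

orderIso′ : List ℕ → List ℕ → Bool
orderIso′ p s = eqLen p s ∧ all sameOrder (pairs (zip p s))

sameOrder⇒< : ∀ {i j u v} → T (sameOrder ((i , u) , (j , v))) → i < j → u < v
sameOrder⇒< {i} {j} {u} {v} agree i<j with i <ᵇ j | <ᵇ-reflects-< i j | u <ᵇ v | <ᵇ-reflects-< u v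
... | true  | _       | true  | ofʸ u<v = u<v
... | true  | _       | false | _       = ⊥-elim agree
... | false | ofⁿ i≮j | _     | _       = contradiction i<j i≮j

orderIso′⇒< : ∀ p s {i j u v} → T (orderIso′ p s) → (i , u) ∈ zip p s → (j , v) ∈ zip p s → i < j → u < v
orderIso′⇒< p s iso iu∈ jv∈ =
  sameOrder⇒< (All.lookup (all⁺ sameOrder (pairs (zip p s)) (proj₂ (Equivalence.to T-∧ iso))) (∈-pairs⁺ iu∈ jv∈))

∈-zip-map⁻ : ∀ (f : ℕ → ℕ) p {a c} → (a , c) ∈ zip p (map f p) → a ∈ p × c ≡ f a
∈-zip-map⁻ f (x ∷ p) (here refl) = here refl , refl
∈-zip-map⁻ f (x ∷ p) (there ac∈) with ∈-zip-map⁻ f p ac∈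
... | a∈ , e = there a∈ , e

eqLen-map : ∀ (f : ℕ → ℕ) p → T (eqLen p (map f p))
eqLen-map f []      = tt
eqLen-map f (_ ∷ p) = eqLen-map f p

orderIso′-map : ∀ (f : ℕ → ℕ) p → (∀ {x y} → x ∈ p → y ∈ p → x < y → f x < f y) → T (orderIso′ p (map f p))
orderIso′-map f p mono = Equivalence.from T-∧ (eqLen-map f p , all⁻ _ (All.tabulate agree))
  where
  reflect-< : ∀ {a b} → a ∈ p → b ∈ p → f a < f b → a < b
  reflect-< {a} {b} a∈ b∈ fa<fb with <-cmp a b
  ... | tri< a<b _ _  = a<b
  ... | tri≈ _ refl _ = contradiction fa<fb (<-irrefl refl)
  ... | tri> _ _ b<a  = contradiction (mono b∈ a∈ b<a) (<-asym fa<fb)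
  agree : ∀ {q} → q ∈ pairs (zip p (map f p)) → T (sameOrder q)
  agree {(a , c) , (b , d)} q∈ with ∈-pairs⁻ q∈
  ... | ac∈ , bd∈ with ∈-zip-map⁻ f p ac∈ | ∈-zip-map⁻ f p bd∈
  ...   | a∈ , refl | b∈ , refl rewrite <ᵇ-cong (mono a∈ b∈) (reflect-< a∈ b∈) with f a <ᵇ f b
  ...     | true  = tt
  ...     | false = tt

<-from-steps : ∀ (f : ℕ → ℕ) {lo hi} → (∀ {i} → lo ≤ i → suc i ≤ hi → f i < f (suc i)) →
  ∀ {x y} → lo ≤ x → x < y → y ≤ hi → f x < f y
<-from-steps f step {x = x} {suc y} lo≤x (s≤s x≤y) y<hi with m≤n⇒m<n∨m≡n x≤y
... | inj₂ refl = step lo≤x y<hi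
... | inj₁ x<y  = <-trans (<-from-steps f step lo≤x x<y (<⇒≤ y<hi)) (step (≤-trans lo≤x x≤y) y<hi)

T-not⁻ : ∀ {b} → T (not b) → ¬ T b
T-not⁻ {false} _ ()

T-not⁺ : ∀ {b} → ¬ T b → T (not b)
T-not⁺ {false} _   = tt
T-not⁺ {true}  ¬tt = ¬tt tt

Avoids321 : List ℕ → Set
Avoids321 ℓ = ∀ {a b c} → a ∷ b ∷ c ∷ [] ⊆ ℓ → c < b → b < a → ⊥

Avoids21354 : List ℕ → Set
Avoids21354 ℓ = ∀ {a b c d e} → a ∷ b ∷ c ∷ d ∷ e ∷ [] ⊆ ℓ → b < a → a < c → c < e → e < d → ⊥

bounds-p321 : ∀ {x} → x ∈ p321 → 1 ≤ x × x ≤ 3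
bounds-p321 (here refl)                 = s≤s z≤n , ≤-refl
bounds-p321 (there (here refl))         = s≤s z≤n , n≤1+n 2
bounds-p321 (there (there (here refl))) = s≤s z≤n , s≤s z≤n

bounds-p21354 : ∀ {x} → x ∈ p21354 → 1 ≤ x × x ≤ 5
bounds-p21354 (here refl)                                 = s≤s z≤n , s≤s (s≤s z≤n)
bounds-p21354 (there (here refl))                         = s≤s z≤n , s≤s z≤n
bounds-p21354 (there (there (here refl)))                 = s≤s z≤n , s≤s (s≤s (s≤s z≤n))
bounds-p21354 (there (there (there (here refl))))         = s≤s z≤n , ≤-refl
bounds-p21354 (there (there (there (there (here refl))))) = s≤s z≤n , n≤1+n 4

avoids321⁻ : ∀ ℓ → T (avoids p321 ℓ) → Avoids321 ℓ
avoids321⁻ ℓ av {a} {b} {c} σ c<b b<a = T-not⁻ av (contains⁺ p321 σ (orderIso′-map rank p321 mono))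
  where
  rank : ℕ → ℕ
  rank 1 = c
  rank 2 = b
  rank _ = a
  step : ∀ {i} → 1 ≤ i → suc i ≤ 3 → rank i < rank (suc i)
  step {1} _ _ = c<b
  step {2} _ _ = b<a
  step {suc (suc (suc _))} _ (s≤s (s≤s (s≤s ())))
  mono : ∀ {x y} → x ∈ p321 → y ∈ p321 → x < y → rank x < rank y
  mono x∈ y∈ x<y = <-from-steps rank step (proj₁ (bounds-p321 x∈)) x<y (proj₂ (bounds-p321 y∈))

avoids321⁺ : ∀ ℓ → Avoids321 ℓ → T (avoids p321 ℓ)
avoids321⁺ ℓ av = T-not⁺ λ c → occurrence (contains⁻ p321 ℓ c)
  where
  occurrence : ∃[ s ] s ⊆ ℓ × T (orderIso p321 s) → ⊥
  occurrence ([] , _ , ())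
  occurrence (_ ∷ [] , _ , ())
  occurrence (_ ∷ _ ∷ [] , _ , ())
  occurrence (_ ∷ _ ∷ _ ∷ _ ∷ _ , _ , ())
  occurrence (a ∷ b ∷ c ∷ [] , σ , iso) =
    av σ (next (there (there (here refl))) (there (here refl))) (next (there (here refl)) (here refl))
    where
    next : ∀ {i u v} → (i , u) ∈ zip p321 (a ∷ b ∷ c ∷ []) → (suc i , v) ∈ zip p321 (a ∷ b ∷ c ∷ []) → u < v
    next iu∈ jv∈ = orderIso′⇒< p321 (a ∷ b ∷ c ∷ []) iso iu∈ jv∈ (n<1+n _)

avoids21354⁻ : ∀ ℓ → T (avoids p21354 ℓ) → Avoids21354 ℓ
avoids21354⁻ ℓ av {a} {b} {c} {d} {e} σ b<a a<c c<e e<d =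
  T-not⁻ av (contains⁺ p21354 σ (orderIso′-map rank p21354 mono))
  where
  rank : ℕ → ℕ
  rank 1 = b
  rank 2 = a
  rank 3 = c
  rank 4 = e
  rank _ = d
  step : ∀ {i} → 1 ≤ i → suc i ≤ 5 → rank i < rank (suc i)
  step {1} _ _ = b<a
  step {2} _ _ = a<c
  step {3} _ _ = c<e
  step {4} _ _ = e<d
  step {suc (suc (suc (suc (suc _))))} _ (s≤s (s≤s (s≤s (s≤s (s≤s ())))))
  mono : ∀ {x y} → x ∈ p21354 → y ∈ p21354 → x < y → rank x < rank y
  mono x∈ y∈ x<y = <-from-steps rank step (proj₁ (bounds-p21354 x∈)) x<y (proj₂ (bounds-p21354 y∈))

avoids21354⁺ : ∀ ℓ → Avoids21354 ℓ → T (avoids p21354 ℓ)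
avoids21354⁺ ℓ av = T-not⁺ λ c → occurrence (contains⁻ p21354 ℓ c)
  where
  occurrence : ∃[ s ] s ⊆ ℓ × T (orderIso p21354 s) → ⊥
  occurrence ([] , _ , ())
  occurrence (_ ∷ [] , _ , ())
  occurrence (_ ∷ _ ∷ [] , _ , ())
  occurrence (_ ∷ _ ∷ _ ∷ [] , _ , ())
  occurrence (_ ∷ _ ∷ _ ∷ _ ∷ [] , _ , ())
  occurrence (_ ∷ _ ∷ _ ∷ _ ∷ _ ∷ _ ∷ _ , _ , ())
  occurrence (a ∷ b ∷ c ∷ d ∷ e ∷ [] , σ , iso) = av σ (next 1-b 2-a) (next 2-a 3-c) (next 3-c 4-e) (next 4-e 5-d)
    where
    next : ∀ {i u v} → (i , u) ∈ zip p21354 (a ∷ b ∷ c ∷ d ∷ e ∷ []) → (suc i , v) ∈ zip p21354 (a ∷ b ∷ c ∷ d ∷ e ∷ []) → u < v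
    next iu∈ jv∈ = orderIso′⇒< p21354 (a ∷ b ∷ c ∷ d ∷ e ∷ []) iso iu∈ jv∈ (n<1+n _)
    2-a = here refl
    1-b = there (here refl)
    3-c = there (there (here refl))
    5-d = there (there (there (here refl)))
    4-e = there (there (there (there (here refl))))

Fishburn : List ℕ → Set
Fishburn ℓ = ¬ T (fishburnBad ℓ)

FishburnAt : ℕ → List ℕ → Set
FishburnAt x []      = ⊤
FishburnAt x (y ∷ r) = x < y → ∀ {z} → z ∈ y ∷ r → x ≡ suc z → ⊥

Fishburn-∷⁻ : ∀ {x ℓ} → Fishburn (x ∷ ℓ) → Fishburn ℓ × FishburnAt x ℓ
Fishburn-∷⁻ {x} {[]}    _ = (λ ()) , tt
Fishburn-∷⁻ {x} {y ∷ r} f = (f ∘ Equivalence.from T-∨ ∘ inj₂) , ascent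
  where
  ascent : FishburnAt x (y ∷ r)
  ascent x<y {z} z∈ x≡1+z = f (Equivalence.from T-∨ (inj₁ (Equivalence.from T-∧ (<⇒<ᵇ x<y ,
    any⁺ _ (lose z∈ (≡⇒≡ᵇ x (z + 1) (trans x≡1+z (+-comm 1 z))))))))

Fishburn-∷⁺ : ∀ {x ℓ} → Fishburn ℓ → FishburnAt x ℓ → Fishburn (x ∷ ℓ)
Fishburn-∷⁺ {x} {[]}    _ _ ()
Fishburn-∷⁺ {x} {y ∷ r} f ascent bad with Equivalence.to T-∨ bad
... | inj₂ bad′ = f bad′
... | inj₁ bad′ with Equivalence.to T-∧ bad′
...   | x<ᵇy , hit with find (any⁻ _ (y ∷ r) hit)
...     | z , z∈ , x≡ᵇ = ascent (<ᵇ⇒< x y x<ᵇy) z∈ (trans (≡ᵇ⇒≡ x (z + 1) x≡ᵇ) (+-comm z 1))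

Good : List ℕ → Set
Good ℓ = Fishburn ℓ × Avoids321 ℓ × Avoids21354 ℓ

GoodAt : ℕ → List ℕ → Set
GoodAt x ℓ = FishburnAt x ℓ
           × (∀ {b c} → b ∷ c ∷ [] ⊆ ℓ → c < b → b < x → ⊥)
           × (∀ {b c d e} → b ∷ c ∷ d ∷ e ∷ [] ⊆ ℓ → b < x → x < c → c < e → e < d → ⊥)

Good-∷⁻ : ∀ {x ℓ} → Good (x ∷ ℓ) → Good ℓ × GoodAt x ℓ
Good-∷⁻ (f , a₃ , a₅) with Fishburn-∷⁻ f
... | fℓ , fx = (fℓ , (λ σ → a₃ (_ ∷ʳ σ)) , (λ σ → a₅ (_ ∷ʳ σ))) , fx , (λ σ → a₃ (refl ∷ σ)) , (λ σ → a₅ (refl ∷ σ))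

Good-∷⁺ : ∀ {x ℓ} → Good ℓ → GoodAt x ℓ → Good (x ∷ ℓ)
Good-∷⁺ (f , a₃ , a₅) (fx , a₃x , a₅x) = Fishburn-∷⁺ f fx , avoid₃ , avoid₅
  where
  avoid₃ : Avoids321 _
  avoid₃ (_ ∷ʳ σ)    = a₃ σ
  avoid₃ (refl ∷ σ)  = a₃x σ
  avoid₅ : Avoids21354 _
  avoid₅ (_ ∷ʳ σ)    = a₅ σ
  avoid₅ (refl ∷ σ)  = a₅x σ

Good-[] : Good []
Good-[] = (λ ()) , (λ ()) , (λ ())

GoodAt-min : ∀ {x ℓ} → (∀ {w} → w ∈ ℓ → x < w) → GoodAt x ℓ
GoodAt-min {x} {ℓ} x<ℓ = fishburn ℓ x<ℓ , (λ σ _ b<x → <-asym b<x (x<ℓ (to∈ σ))) , (λ σ b<x _ _ _ → <-asym b<x (x<ℓ (to∈ σ)))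
  where
  fishburn : ∀ ℓ → (∀ {w} → w ∈ ℓ → x < w) → FishburnAt x ℓ
  fishburn []      _    = tt
  fishburn (y ∷ r) x<ℓ′ _ z∈ refl = <-irrefl refl (<-trans (x<ℓ′ z∈) (n<1+n _))

good? : List ℕ → Bool
good? π = isFishburn π ∧ avoids p321 π ∧ avoids p21354 π

T-good?⇔Good : ∀ π → T (good? π) ⇔ Good π
T-good?⇔Good π = mk⇔ to from
  where
  to : T (good? π) → Good π
  to g with Equivalence.to T-∧ g
  ... | f , a with Equivalence.to T-∧ a
  ...   | a₃ , a₅ = T-not⁻ f , avoids321⁻ π a₃ , avoids21354⁻ π a₅
  from : Good π → T (good? π)
  from (f , a₃ , a₅) = Equivalence.from T-∧ (T-not⁺ f , Equivalence.from T-∧ (avoids321⁺ π a₃ , avoids21354⁺ π a₅))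

IsPerm : ℕ → ℕ → List ℕ → Set
IsPerm a n π = Unique π × (∀ {z} → z ∈ π → a < z × z ≤ a + n) × (∀ {z} → a < z → z ≤ a + n → z ∈ π)

∈-words⁻ : ∀ k xs {π} → π ∈ words k xs → length π ≡ k × All (_∈ xs) π
∈-words⁻ zero    xs (here refl) = refl , []
∈-words⁻ (suc k) xs π∈ with find (∈-concatMap⁻ (λ x → map (x ∷_) (words k xs)) {xs = xs} π∈)
... | x , x∈ , π∈′ with ∈-map⁻ (x ∷_) π∈′
...   | π′ , π′∈ , refl with ∈-words⁻ k xs π′∈
...     | len , all∈ = cong suc len , x∈ ∷ all∈

∈-words⁺ : ∀ k xs {π} → length π ≡ k → All (_∈ xs) π → π ∈ words k xs
∈-words⁺ zero    xs {[]}    _   []           = here refl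
∈-words⁺ (suc k) xs {x ∷ π} len (x∈ ∷ all∈) =
  ∈-concatMap⁺ (λ y → map (y ∷_) (words k xs)) {xs = xs} (lose x∈ (∈-map⁺ (x ∷_) (∈-words⁺ k xs (suc-injective len) all∈)))

distinct⇔Unique : ∀ π → T (distinct π) ⇔ Unique π
distinct⇔Unique π = mk⇔ (to π) (from π)
  where
  to : ∀ π → T (distinct π) → Unique π
  to []      _ = []
  to (x ∷ π) d with Equivalence.to T-∧ d
  ... | fresh , d′ = All.map (λ ne e → T-not⁻ ne (≡⇒≡ᵇ x _ e)) (all⁺ _ π fresh) ∷ to π d′
  from : ∀ π → Unique π → T (distinct π)
  from []      _           = tt
  from (x ∷ π) (fresh ∷ u) =
    Equivalence.from T-∧ (all⁻ _ (All.map (λ ne → T-not⁺ (ne ∘ ≡ᵇ⇒≡ x _)) fresh) , from π u)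

∈-range1⁻ : ∀ n {z} → z ∈ range1 n → 0 < z × z ≤ n
∈-range1⁻ n z∈ with ∈-applyUpTo⁻ suc z∈
... | i , i<n , refl = s≤s z≤n , i<n

∈-range1⁺ : ∀ n {z} → 0 < z → z ≤ n → z ∈ range1 n
∈-range1⁺ n {suc i} _ i<n = ∈-applyUpTo⁺ suc i<n

range1-unique : ∀ n → Unique (range1 n)
range1-unique n = applyUpTo⁺₁ suc n (λ i<j _ e → <⇒≢ i<j (suc-injective e))

∈-++-∷⁻ : ∀ {A : Set} {x y : A} xs {ys} → x ∈ xs ++ y ∷ ys → x ≢ y → x ∈ xs ++ ys
∈-++-∷⁻ xs x∈ x≢y with ∈-++⁻ xs x∈
... | inj₁ x∈ˡ         = ∈-++⁺ˡ x∈ˡ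
... | inj₂ (here x≡y)  = contradiction x≡y x≢y
... | inj₂ (there x∈ʳ) = ∈-++⁺ʳ xs x∈ʳ

length-++-∷ : ∀ {A : Set} {y : A} xs ys → length (xs ++ y ∷ ys) ≡ suc (length (xs ++ ys))
length-++-∷ {y = y} xs ys = begin
  length (xs ++ y ∷ ys)       ≡⟨ length-++ xs ⟩
  length xs + suc (length ys) ≡⟨ +-suc (length xs) (length ys) ⟩
  suc (length xs + length ys) ≡⟨ cong suc (sym (length-++ xs)) ⟩
  suc (length (xs ++ ys))     ∎

unique-⊆⇒length≤ : ∀ {A : Set} {xs ys : List A} → Unique xs → (∀ {z} → z ∈ xs → z ∈ ys) → length xs ≤ length ys
unique-⊆⇒length≤ {xs = []}     _          _  = z≤n
unique-⊆⇒length≤ {xs = x ∷ xs} (fresh ∷ u) xs⊆ys with ∈-∃++ (xs⊆ys (here refl))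
... | as , bs , refl rewrite length-++-∷ {y = x} as bs =
  s≤s (unique-⊆⇒length≤ u (λ z∈ → ∈-++-∷⁻ as (xs⊆ys (there z∈)) (λ { refl → All.lookup fresh z∈ refl })))

unique-⊆-length≥⇒⊇ : ∀ {xs ys : List ℕ} → Unique xs → (∀ {z} → z ∈ xs → z ∈ ys) →
  length ys ≤ length xs → ∀ {y} → y ∈ ys → y ∈ xs
unique-⊆-length≥⇒⊇ {xs} u xs⊆ys ys≤xs {y} y∈ with y ∈? xs
... | yes y∈xs = y∈xs
... | no  y∉xs with ∈-∃++ y∈
...   | as , bs , refl = contradiction ys≤xs (<⇒≱ (subst (length xs <_) (sym (length-++-∷ as bs))
          (s≤s (unique-⊆⇒length≤ u (λ z∈ → ∈-++-∷⁻ as (xs⊆ys z∈) (λ { refl → y∉xs z∈ }))))))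

∈-perms⁻ : ∀ n {π} → π ∈ perms n → IsPerm 0 n π
∈-perms⁻ n {π} π∈ with ∈-filter⁻ (T? ∘ distinct) {xs = words n (range1 n)} π∈
... | π∈w , d with ∈-words⁻ n (range1 n) π∈w
...   | len , all∈ = u , (λ z∈ → ∈-range1⁻ n (All.lookup all∈ z∈)) ,
                     (λ 0<z z≤ → unique-⊆-length≥⇒⊇ u (All.lookup all∈) range≤π (∈-range1⁺ n 0<z z≤))
  where
  u = Equivalence.to (distinct⇔Unique π) d
  range≤π = ≤-reflexive (trans (length-applyUpTo suc n) (sym len))

IsPerm⇒length≡ : ∀ n {π} → IsPerm 0 n π → length π ≡ n
IsPerm⇒length≡ n (u , inRange , covers) = trans
  (unique∧set⇒length≡ u (range1-unique n) (λ z∈ → let (0<z , z≤) = inRange z∈ in ∈-range1⁺ n 0<z z≤)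
                                          (λ z∈ → let (0<z , z≤) = ∈-range1⁻ n z∈ in covers 0<z z≤))
  (length-applyUpTo suc n)

∈-perms⁺ : ∀ n {π} → IsPerm 0 n π → π ∈ perms n
∈-perms⁺ n {π} p@(u , inRange , _) = ∈-filter⁺ (T? ∘ distinct) {xs = words n (range1 n)}
  (∈-words⁺ n (range1 n) (IsPerm⇒length≡ n p) (All.tabulate λ z∈ → let (0<z , z≤) = inRange z∈ in ∈-range1⁺ n 0<z z≤))
  (Equivalence.from (distinct⇔Unique π) u)

IsPerm-∷-min⁺ : ∀ {a n σ} → IsPerm (suc a) n σ → IsPerm a (suc n) (suc a ∷ σ)
IsPerm-∷-min⁺ {a} {n} {σ} (u , inRange , covers) = All.tabulate (λ z∈ e → <-irrefl e (proj₁ (inRange z∈))) ∷ u , inRange′ , covers′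
  where
  inRange′ : ∀ {z} → z ∈ suc a ∷ σ → a < z × z ≤ a + suc n
  inRange′ (here refl) = n<1+n a , subst (suc a ≤_) (sym (+-suc a n)) (s≤s (m≤m+n a n))
  inRange′ {z} (there z∈) = <-trans (n<1+n a) (proj₁ (inRange z∈)) , subst (z ≤_) (sym (+-suc a n)) (proj₂ (inRange z∈))
  covers′ : ∀ {z} → a < z → z ≤ a + suc n → z ∈ suc a ∷ σ
  covers′ {z} a<z z≤t with z ≟ suc a
  ... | yes refl    = here refl
  ... | no z≢a+1    = there (covers (≤∧≢⇒< a<z (z≢a+1 ∘ sym)) (subst (z ≤_) (+-suc a n) z≤t))

IsPerm-∷-min⁻ : ∀ {a n σ} → IsPerm a (suc n) (suc a ∷ σ) → IsPerm (suc a) n σ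
IsPerm-∷-min⁻ {a} {n} {σ} (a+1∉σ ∷ u , inRange , covers) = u , inRange′ , covers′
  where
  inRange′ : ∀ {z} → z ∈ σ → suc a < z × z ≤ suc a + n
  inRange′ {z} z∈ = ≤∧≢⇒< (proj₁ (inRange (there z∈))) (All.lookup a+1∉σ z∈)
                  , subst (z ≤_) (+-suc a n) (proj₂ (inRange (there z∈)))
  covers′ : ∀ {z} → suc a < z → z ≤ suc a + n → z ∈ σ
  covers′ {z} a+1<z z≤t with covers (<-trans (n<1+n a) a+1<z) (subst (z ≤_) (sym (+-suc a n)) z≤t)
  ... | here refl = contradiction a+1<z (<-irrefl refl)
  ... | there z∈  = z∈

Good-∷-min⁺ : ∀ {a n σ} → IsPerm (suc a) n σ → Good σ → Good (suc a ∷ σ)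
Good-∷-min⁺ (_ , inRange , _) good = Good-∷⁺ good (GoodAt-min (proj₁ ∘ inRange))

-- The shape of a good permutation k ∷ ℓ of a < z ≤ t with k > a + 1

-- After the jump to m, the rest of the tail interleaves three increasing runs:
-- the low values ns, …, k − 1 not yet placed, the middle values k + 1, …, m − 1
-- and the high values m + 1, …, t; the indices ns, nl, ny are the next value of
-- each run.  A middle value may come only after all low ones, and a high value
-- only while no middle value has been placed or after all of them; directly
-- after m (phase fresh) a high value needs the middle run to be empty.
data Phase : Set where
  fresh settled : Phase

HighOK : ℕ → ℕ → Phase → ℕ → Set
HighOK k m fresh   nl = m ≡ suc k
HighOK k m settled nl = nl ≡ suc k ⊎ nl ≡ m

data Merge (k m t : ℕ) : ℕ → ℕ → ℕ → Phase → List ℕ → Set where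
  done : ∀ {ph} → Merge k m t k m (suc t) ph []
  low  : ∀ {ns nl ny ph ℓ} → ns < k → Merge k m t (suc ns) nl ny settled ℓ → Merge k m t ns nl ny ph (ns ∷ ℓ)
  mid  : ∀ {nl ny ph ℓ} → nl < m → Merge k m t k (suc nl) ny settled ℓ → Merge k m t k nl ny ph (nl ∷ ℓ)
  high : ∀ {ns nl ny ph ℓ} → ny ≤ t → HighOK k m ph nl → Merge k m t ns nl (suc ny) settled ℓ →
         Merge k m t ns nl ny ph (ny ∷ ℓ)

-- The tail starts with the increasing run ns, ns + 1, … of low values, and then
-- either ends (when k = t and the run reaches k − 1) or jumps to some m > k.
data Tail (a k t : ℕ) : ℕ → List ℕ → Set where
  stop : k ≡ t → Tail a k t k []
  run  : ∀ {ns ℓ} → ns < k → Tail a k t (suc ns) ℓ → Tail a k t ns (ns ∷ ℓ)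
  jump : ∀ {ns m ℓ} → suc a < ns → k < m → m ≤ t → Merge k m t ns (suc k) (suc m) fresh ℓ → Tail a k t ns (m ∷ ℓ)

module MergeFacts (k m t : ℕ) where

  Remaining : ℕ → ℕ → ℕ → ℕ → Set
  Remaining ns nl ny z = (ns ≤ z × z < k) ⊎ (nl ≤ z × z < m) ⊎ (ny ≤ z × z ≤ t)

  ∈-Merge⁻ : ∀ {ns nl ny ph ℓ z} → Merge k m t ns nl ny ph ℓ → z ∈ ℓ → Remaining ns nl ny z
  ∈-Merge⁻ (low ns<k μ) (here refl) = inj₁ (≤-refl , ns<k)
  ∈-Merge⁻ (low ns<k μ) (there z∈) with ∈-Merge⁻ μ z∈
  ... | inj₁ (ns<z , z<k) = inj₁ (<⇒≤ ns<z , z<k)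
  ... | inj₂ rest         = inj₂ rest
  ∈-Merge⁻ (mid nl<m μ) (here refl) = inj₂ (inj₁ (≤-refl , nl<m))
  ∈-Merge⁻ (mid nl<m μ) (there z∈) with ∈-Merge⁻ μ z∈
  ... | inj₁ lo                     = inj₁ lo
  ... | inj₂ (inj₁ (nl<z , z<m))    = inj₂ (inj₁ (<⇒≤ nl<z , z<m))
  ... | inj₂ (inj₂ hi)              = inj₂ (inj₂ hi)
  ∈-Merge⁻ (high ny≤t _ μ) (here refl) = inj₂ (inj₂ (≤-refl , ny≤t))
  ∈-Merge⁻ (high ny≤t _ μ) (there z∈) with ∈-Merge⁻ μ z∈
  ... | inj₁ lo                     = inj₁ lo
  ... | inj₂ (inj₁ mi)              = inj₂ (inj₁ mi)
  ... | inj₂ (inj₂ (ny<z , z≤t))    = inj₂ (inj₂ (<⇒≤ ny<z , z≤t))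

  ∈-Merge⁺ : ∀ {ns nl ny ph ℓ z} → Merge k m t ns nl ny ph ℓ → Remaining ns nl ny z → z ∈ ℓ
  ∈-Merge⁺ done (inj₁ (k≤z , z<k))         = contradiction (<-≤-trans z<k k≤z) (<-irrefl refl)
  ∈-Merge⁺ done (inj₂ (inj₁ (m≤z , z<m)))  = contradiction (<-≤-trans z<m m≤z) (<-irrefl refl)
  ∈-Merge⁺ done (inj₂ (inj₂ (t<z , z≤t)))  = contradiction (≤-<-trans z≤t t<z) (<-irrefl refl)
  ∈-Merge⁺ {ns = ns} {z = z} (low _ μ) (inj₁ (ns≤z , z<k)) with ns ≟ z
  ... | yes refl = here refl
  ... | no ns≢z  = there (∈-Merge⁺ μ (inj₁ (≤∧≢⇒< ns≤z ns≢z , z<k)))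
  ∈-Merge⁺ (low _ μ) (inj₂ r) = there (∈-Merge⁺ μ (inj₂ r))
  ∈-Merge⁺ (mid _ μ) (inj₁ r) = there (∈-Merge⁺ μ (inj₁ r))
  ∈-Merge⁺ {nl = nl} {z = z} (mid _ μ) (inj₂ (inj₁ (nl≤z , z<m))) with nl ≟ z
  ... | yes refl = here refl
  ... | no nl≢z  = there (∈-Merge⁺ μ (inj₂ (inj₁ (≤∧≢⇒< nl≤z nl≢z , z<m))))
  ∈-Merge⁺ (mid _ μ) (inj₂ (inj₂ r)) = there (∈-Merge⁺ μ (inj₂ (inj₂ r)))
  ∈-Merge⁺ (high _ _ μ) (inj₁ r)        = there (∈-Merge⁺ μ (inj₁ r))
  ∈-Merge⁺ (high _ _ μ) (inj₂ (inj₁ r)) = there (∈-Merge⁺ μ (inj₂ (inj₁ r)))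
  ∈-Merge⁺ {ny = ny} {z = z} (high _ _ μ) (inj₂ (inj₂ (ny≤z , z≤t))) with ny ≟ z
  ... | yes refl = here refl
  ... | no ny≢z  = there (∈-Merge⁺ μ (inj₂ (inj₂ (≤∧≢⇒< ny≤z ny≢z , z≤t))))

  module Separated (k<m : k < m) where

    low-below-rest : ∀ {ns nl ny ph ℓ} → ns < k → k < nl → m < ny → Merge k m t (suc ns) nl ny ph ℓ →
      ∀ {w} → w ∈ ℓ → ns < w
    low-below-rest ns<k k<nl m<ny μ w∈ with ∈-Merge⁻ μ w∈
    ... | inj₁ (ns<w , _)        = ns<w
    ... | inj₂ (inj₁ (nl≤w , _)) = <-trans ns<k (<-≤-trans k<nl nl≤w)
    ... | inj₂ (inj₂ (ny≤w , _)) = <-trans ns<k (<-trans k<m (<-≤-trans m<ny ny≤w))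

    mid-below-rest : ∀ {nl ny ph ℓ} → nl < m → m < ny → Merge k m t k (suc nl) ny ph ℓ → ∀ {w} → w ∈ ℓ → nl < w
    mid-below-rest nl<m m<ny μ w∈ with ∈-Merge⁻ μ w∈
    ... | inj₁ (k≤w , w<k)       = contradiction (<-≤-trans w<k k≤w) (<-irrefl refl)
    ... | inj₂ (inj₁ (nl<w , _)) = nl<w
    ... | inj₂ (inj₂ (ny≤w , _)) = <-trans nl<m (<-≤-trans m<ny ny≤w)

    high-not-in-rest : ∀ {ns nl ny ph ℓ} → m < ny → Merge k m t ns nl (suc ny) ph ℓ → ∀ {w} → w ∈ ℓ → w ≢ ny
    high-not-in-rest m<ny μ w∈ refl with ∈-Merge⁻ μ w∈
    ... | inj₁ (_ , w<k)         = <-asym (<-trans w<k k<m) m<ny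
    ... | inj₂ (inj₁ (_ , w<m))  = <-asym w<m m<ny
    ... | inj₂ (inj₂ (ny<w , _)) = <-irrefl refl ny<w

    Merge-unique : ∀ {ns nl ny ph ℓ} → k < nl → m < ny → Merge k m t ns nl ny ph ℓ → Unique ℓ
    Merge-unique k<nl m<ny done = []
    Merge-unique k<nl m<ny (low ns<k μ) =
      All.tabulate (λ w∈ e → <-irrefl e (low-below-rest ns<k k<nl m<ny μ w∈)) ∷ Merge-unique k<nl m<ny μ
    Merge-unique k<nl m<ny (mid nl<m μ) =
      All.tabulate (λ w∈ e → <-irrefl e (mid-below-rest nl<m m<ny μ w∈)) ∷ Merge-unique (<-trans k<nl (n<1+n _)) m<ny μ
    Merge-unique k<nl m<ny (high _ _ μ) =
      All.tabulate (λ w∈ e → high-not-in-rest m<ny μ w∈ (sym e)) ∷ Merge-unique k<nl (<-trans m<ny (n<1+n _)) μ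

    increasing-below-m : ∀ {ns nl ny ph ℓ u v} → k < nl → m < ny → Merge k m t ns nl ny ph ℓ →
      u ∷ v ∷ [] ⊆ ℓ → u < m → v < m → u < v
    increasing-below-m k<nl m<ny (low ns<k μ)  (refl ∷ σ) u<m v<m = low-below-rest ns<k k<nl m<ny μ (to∈ σ)
    increasing-below-m k<nl m<ny (low ns<k μ)  (_ ∷ʳ σ)   u<m v<m = increasing-below-m k<nl m<ny μ σ u<m v<m
    increasing-below-m k<nl m<ny (mid nl<m μ)  (refl ∷ σ) u<m v<m = mid-below-rest nl<m m<ny μ (to∈ σ)
    increasing-below-m k<nl m<ny (mid nl<m μ)  (_ ∷ʳ σ)   u<m v<m =
      increasing-below-m (<-trans k<nl (n<1+n _)) m<ny μ σ u<m v<m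
    increasing-below-m k<nl m<ny (high _ _ μ)  (refl ∷ σ) u<m v<m = contradiction u<m (<-asym m<ny)
    increasing-below-m k<nl m<ny (high _ _ μ)  (_ ∷ʳ σ)   u<m v<m =
      increasing-below-m k<nl (<-trans m<ny (n<1+n _)) μ σ u<m v<m

    increasing-above-m : ∀ {ns nl ny ph ℓ u v} → k < nl → m < ny → Merge k m t ns nl ny ph ℓ →
      u ∷ v ∷ [] ⊆ ℓ → m < u → m < v → u < v
    increasing-above-m k<nl m<ny (low ns<k μ) (refl ∷ σ) m<u m<v = contradiction (<-trans ns<k k<m) (<-asym m<u)
    increasing-above-m k<nl m<ny (low ns<k μ) (_ ∷ʳ σ)   m<u m<v = increasing-above-m k<nl m<ny μ σ m<u m<v
    increasing-above-m k<nl m<ny (mid nl<m μ) (refl ∷ σ) m<u m<v = contradiction nl<m (<-asym m<u)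
    increasing-above-m k<nl m<ny (mid nl<m μ) (_ ∷ʳ σ)   m<u m<v =
      increasing-above-m (<-trans k<nl (n<1+n _)) m<ny μ σ m<u m<v
    increasing-above-m k<nl m<ny (high _ _ μ) (refl ∷ σ) m<u m<v with ∈-Merge⁻ μ (to∈ σ)
    ... | inj₁ (_ , v<k)         = contradiction (<-trans v<k k<m) (<-asym m<v)
    ... | inj₂ (inj₁ (_ , v<m))  = contradiction v<m (<-asym m<v)
    ... | inj₂ (inj₂ (ny<v , _)) = ny<v
    increasing-above-m k<nl m<ny (high _ _ μ) (_ ∷ʳ σ)   m<u m<v =
      increasing-above-m k<nl (<-trans m<ny (n<1+n _)) μ σ m<u m<v

    no-high-then-mid : ∀ {ns nl ny ph ℓ d e} → suc k < nl → m < ny → Merge k m t ns nl ny ph ℓ →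
      d ∷ e ∷ [] ⊆ ℓ → m < d → k < e → e < m → ⊥
    no-high-then-mid k+1<nl m<ny (low ns<k μ) (refl ∷ σ) m<d k<e e<m = <-asym m<d (<-trans ns<k k<m)
    no-high-then-mid k+1<nl m<ny (low ns<k μ) (_ ∷ʳ σ)   m<d k<e e<m = no-high-then-mid k+1<nl m<ny μ σ m<d k<e e<m
    no-high-then-mid k+1<nl m<ny (mid nl<m μ) (refl ∷ σ) m<d k<e e<m = <-asym m<d nl<m
    no-high-then-mid k+1<nl m<ny (mid nl<m μ) (_ ∷ʳ σ)   m<d k<e e<m =
      no-high-then-mid (<-trans k+1<nl (n<1+n _)) m<ny μ σ m<d k<e e<m
    no-high-then-mid {ph = ph} k+1<nl m<ny (high _ ok μ) (refl ∷ σ) m<d k<e e<m with ∈-Merge⁻ μ (to∈ σ)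
    ... | inj₁ (_ , e<k)         = <-asym k<e e<k
    ... | inj₂ (inj₂ (ny<e , _)) = <-asym e<m (<-trans m<ny (<-≤-trans (n<1+n _) ny<e))
    ... | inj₂ (inj₁ (nl≤e , _)) with ph | ok
    ...   | fresh   | refl       = <⇒≱ k<e (≤-pred e<m)
    ...   | settled | inj₁ refl  = <-irrefl refl k+1<nl
    ...   | settled | inj₂ refl  = <-irrefl refl (<-≤-trans e<m nl≤e)
    no-high-then-mid k+1<nl m<ny (high _ _ μ) (_ ∷ʳ σ)   m<d k<e e<m =
      no-high-then-mid k+1<nl (<-trans m<ny (n<1+n _)) μ σ m<d k<e e<m

    no-mid-high-mid : ∀ {ns nl ny ph ℓ c d e} → k < nl → m < ny → Merge k m t ns nl ny ph ℓ →
      c ∷ d ∷ e ∷ [] ⊆ ℓ → k < c → c < m → m < d → k < e → e < m → ⊥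
    no-mid-high-mid k<nl m<ny (low ns<k μ)  (refl ∷ σ) k<c c<m m<d k<e e<m = <-asym k<c ns<k
    no-mid-high-mid k<nl m<ny (low ns<k μ)  (_ ∷ʳ σ)   k<c c<m m<d k<e e<m = no-mid-high-mid k<nl m<ny μ σ k<c c<m m<d k<e e<m
    no-mid-high-mid k<nl m<ny (mid nl<m μ)  (refl ∷ σ) k<c c<m m<d k<e e<m = no-high-then-mid (s≤s k<nl) m<ny μ σ m<d k<e e<m
    no-mid-high-mid k<nl m<ny (mid nl<m μ)  (_ ∷ʳ σ)   k<c c<m m<d k<e e<m =
      no-mid-high-mid (<-trans k<nl (n<1+n _)) m<ny μ σ k<c c<m m<d k<e e<m
    no-mid-high-mid k<nl m<ny (high _ _ μ)  (refl ∷ σ) k<c c<m m<d k<e e<m = <-asym c<m m<ny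
    no-mid-high-mid k<nl m<ny (high _ _ μ)  (_ ∷ʳ σ)   k<c c<m m<d k<e e<m =
      no-mid-high-mid k<nl (<-trans m<ny (n<1+n _)) μ σ k<c c<m m<d k<e e<m

    FishburnAt-high : ∀ {ns nl ny ph ℓ} → m < ny → Merge k m t ns nl (suc ny) ph ℓ → FishburnAt ny ℓ
    FishburnAt-high {ℓ = []}    m<ny μ = tt
    FishburnAt-high {ℓ = _ ∷ _} m<ny μ _ {z} z∈ refl with ∈-Merge⁻ μ z∈
    ... | inj₁ (_ , z<k)         = <⇒≱ m<ny (<-trans z<k k<m)
    ... | inj₂ (inj₁ (_ , z<m))  = <⇒≱ m<ny z<m
    ... | inj₂ (inj₂ (1+z<z , _)) = <-asym 1+z<z (n<1+n _)

    Merge-good : ∀ {ns nl ny ph ℓ} → k < nl → m < ny → Merge k m t ns nl ny ph ℓ → Good ℓ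
    Merge-good k<nl m<ny done = Good-[]
    Merge-good k<nl m<ny (low ns<k μ) =
      Good-∷⁺ (Merge-good k<nl m<ny μ) (GoodAt-min (low-below-rest ns<k k<nl m<ny μ))
    Merge-good k<nl m<ny (mid nl<m μ) =
      Good-∷⁺ (Merge-good (<-trans k<nl (n<1+n _)) m<ny μ) (GoodAt-min (mid-below-rest nl<m m<ny μ))
    Merge-good k<nl m<ny (high _ _ μ) =
      Good-∷⁺ (Merge-good k<nl m<ny′ μ) (FishburnAt-high m<ny μ , no-321 , no-21354)
      where
      m<ny′ = <-trans m<ny (n<1+n _)
      no-321 : ∀ {b c} → b ∷ c ∷ [] ⊆ _ → c < b → b < _ → ⊥
      no-321 σ c<b b<ny with ∈-Merge⁻ μ (to∈ σ)
      ... | inj₁ (_ , b<k)         = <-asym (increasing-below-m k<nl m<ny′ μ σ (<-trans b<k k<m) (<-trans c<b (<-trans b<k k<m))) c<b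
      ... | inj₂ (inj₁ (_ , b<m))  = <-asym (increasing-below-m k<nl m<ny′ μ σ b<m (<-trans c<b b<m)) c<b
      ... | inj₂ (inj₂ (ny<b , _)) = <-asym b<ny ny<b
      no-21354 : ∀ {b c d e} → b ∷ c ∷ d ∷ e ∷ [] ⊆ _ → b < _ → _ < c → c < e → e < d → ⊥
      no-21354 σ _ ny<c c<e e<d = <-asym e<d (increasing-above-m k<nl m<ny′ μ (∷ˡ⁻ (∷ˡ⁻ σ))
        (<-trans m<ny (<-trans ny<c (<-trans c<e e<d))) (<-trans m<ny (<-trans ny<c c<e)))

    fresh-high⇒m≡1+k : ∀ {ns ny y ℓ} → Merge k m t ns (suc k) ny fresh (y ∷ ℓ) → m < y → m ≡ suc k
    fresh-high⇒m≡1+k (low ns<k _)   m<y = contradiction (<-trans ns<k k<m) (<-asym m<y)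
    fresh-high⇒m≡1+k (mid nl<m _)   m<y = contradiction nl<m (<-asym m<y)
    fresh-high⇒m≡1+k (high _ ok _)  m<y = ok

module TailFacts (a k t : ℕ) where
  open MergeFacts

  ∈-Tail⁻ : ∀ {ns ℓ z} → Tail a k t ns ℓ → z ∈ ℓ → (ns ≤ z × z < k) ⊎ (k < z × z ≤ t)
  ∈-Tail⁻ (run ns<k τ) (here refl) = inj₁ (≤-refl , ns<k)
  ∈-Tail⁻ (run ns<k τ) (there z∈) with ∈-Tail⁻ τ z∈
  ... | inj₁ (ns<z , z<k) = inj₁ (<⇒≤ ns<z , z<k)
  ... | inj₂ above        = inj₂ above
  ∈-Tail⁻ (jump _ k<m m≤t μ) (here refl) = inj₂ (k<m , m≤t)
  ∈-Tail⁻ (jump {m = m} _ k<m m≤t μ) (there z∈) with ∈-Merge⁻ k m t μ z∈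
  ... | inj₁ below                 = inj₁ below
  ... | inj₂ (inj₁ (k<z , z<m))    = inj₂ (k<z , ≤-trans (<⇒≤ z<m) m≤t)
  ... | inj₂ (inj₂ (m<z , z≤t))    = inj₂ (<-trans k<m (<-≤-trans (n<1+n m) m<z) , z≤t)

  ∈-Tail⁺ : ∀ {ns ℓ z} → Tail a k t ns ℓ → (ns ≤ z × z < k) ⊎ (k < z × z ≤ t) → z ∈ ℓ
  ∈-Tail⁺ (stop _)    (inj₁ (k≤z , z<k)) = contradiction (<-≤-trans z<k k≤z) (<-irrefl refl)
  ∈-Tail⁺ (stop refl) (inj₂ (k<z , z≤k)) = contradiction (<-≤-trans k<z z≤k) (<-irrefl refl)
  ∈-Tail⁺ {ns = ns} {z = z} (run _ τ) (inj₁ (ns≤z , z<k)) with ns ≟ z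
  ... | yes refl = here refl
  ... | no ns≢z  = there (∈-Tail⁺ τ (inj₁ (≤∧≢⇒< ns≤z ns≢z , z<k)))
  ∈-Tail⁺ (run _ τ) (inj₂ above) = there (∈-Tail⁺ τ (inj₂ above))
  ∈-Tail⁺ (jump {m = m} _ k<m _ μ) (inj₁ below) = there (∈-Merge⁺ k m t μ (inj₁ below))
  ∈-Tail⁺ {z = z} (jump {m = m} _ k<m _ μ) (inj₂ (k<z , z≤t)) with <-cmp z m
  ... | tri≈ _ refl _ = here refl
  ... | tri< z<m _ _  = there (∈-Merge⁺ k m t μ (inj₂ (inj₁ (k<z , z<m))))
  ... | tri> _ _ m<z  = there (∈-Merge⁺ k m t μ (inj₂ (inj₂ (m<z , z≤t))))

  Tail-unique : ∀ {ns ℓ} → Tail a k t ns ℓ → Unique ℓ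
  Tail-unique (stop _) = []
  Tail-unique (run ns<k τ) = All.tabulate (λ w∈ e → fresh-run τ ns<k w∈ (sym e)) ∷ Tail-unique τ
    where
    fresh-run : ∀ {ns ℓ w} → Tail a k t (suc ns) ℓ → ns < k → w ∈ ℓ → w ≢ ns
    fresh-run τ ns<k w∈ refl with ∈-Tail⁻ τ w∈
    ... | inj₁ (ns<ns , _) = <-irrefl refl ns<ns
    ... | inj₂ (k<ns , _)  = <-asym k<ns ns<k
  Tail-unique (jump {m = m} _ k<m _ μ) = All.tabulate (λ w∈ e → fresh-jump w∈ (sym e)) ∷ Merge-unique (n<1+n k) (n<1+n m) μ
    where
    open MergeFacts.Separated k m t k<m
    fresh-jump : ∀ {w} → w ∈ _ → w ≢ m
    fresh-jump w∈ refl with ∈-Merge⁻ k m t μ w∈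
    ... | inj₁ (_ , m<k)        = <-asym m<k k<m
    ... | inj₂ (inj₁ (_ , m<m)) = <-irrefl refl m<m
    ... | inj₂ (inj₂ (m<m , _)) = <-irrefl refl m<m

  increasing-below-k : ∀ {ns ℓ u v} → Tail a k t ns ℓ → u ∷ v ∷ [] ⊆ ℓ → u < k → v < k → u < v
  increasing-below-k (run _ τ) (refl ∷ σ) u<k v<k with ∈-Tail⁻ τ (to∈ σ)
  ... | inj₁ (ns<v , _) = ns<v
  ... | inj₂ (k<v , _)  = contradiction k<v (<-asym v<k)
  increasing-below-k (run _ τ) (_ ∷ʳ σ) u<k v<k = increasing-below-k τ σ u<k v<k
  increasing-below-k (jump _ k<m _ _) (refl ∷ σ) u<k v<k = contradiction k<m (<-asym u<k)
  increasing-below-k (jump {m = m} _ k<m _ μ) (_ ∷ʳ σ) u<k v<k =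
    increasing-below-m (n<1+n k) (n<1+n m) μ σ (<-trans u<k k<m) (<-trans v<k k<m)
    where open MergeFacts.Separated k m t k<m

  no-132-above-k : ∀ {ns ℓ c d e} → Tail a k t ns ℓ → c ∷ d ∷ e ∷ [] ⊆ ℓ → k < c → c < e → e < d → ⊥
  no-132-above-k (run ns<k _) (refl ∷ σ) k<c c<e e<d = <-asym k<c ns<k
  no-132-above-k (run _ τ)    (_ ∷ʳ σ)   k<c c<e e<d = no-132-above-k τ σ k<c c<e e<d
  no-132-above-k (jump {m = m} _ k<m _ μ) (refl ∷ σ) k<c c<e e<d =
    <-asym e<d (increasing-above-m (n<1+n k) (n<1+n m) μ σ (<-trans c<e e<d) c<e)
    where open MergeFacts.Separated k m t k<m
  no-132-above-k {c = c} {d} {e} (jump {m = m} _ k<m _ μ) (_ ∷ʳ σ) k<c c<e e<d = classify-e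
    where
    open MergeFacts.Separated k m t k<m
    μ-above-m = increasing-above-m (n<1+n k) (n<1+n m) μ
    classify-e : ⊥
    classify-e with ∈-Merge⁻ k m t μ (to∈ (∷ˡ⁻ (∷ˡ⁻ σ)))
    ... | inj₁ (_ , e<k)        = <-asym e<k (<-trans k<c c<e)
    ... | inj₂ (inj₂ (m<e , _)) = <-asym e<d (μ-above-m (∷ˡ⁻ σ) (<-trans (<-≤-trans (n<1+n m) m<e) e<d) (<-≤-trans (n<1+n m) m<e))
    ... | inj₂ (inj₁ (_ , e<m)) with ∈-Merge⁻ k m t μ (to∈ (∷ˡ⁻ σ))
    ...   | inj₁ (_ , d<k)        = <-asym d<k (<-trans k<c (<-trans c<e e<d))
    ...   | inj₂ (inj₁ (_ , d<m)) = <-asym e<d (increasing-below-m (n<1+n k) (n<1+n m) μ (∷ˡ⁻ σ) d<m e<m)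
    ...   | inj₂ (inj₂ (m<d , _)) with ∈-Merge⁻ k m t μ (to∈ σ)
    ...     | inj₁ (_ , c<k)        = <-asym c<k k<c
    ...     | inj₂ (inj₁ (_ , c<m)) =
      no-mid-high-mid (n<1+n k) (n<1+n m) μ σ k<c c<m (<-≤-trans (n<1+n m) m<d) (<-trans k<c c<e) e<m
    ...     | inj₂ (inj₂ (m<c , _)) = <-asym e<m (<-trans (<-≤-trans (n<1+n m) m<c) c<e)

  Tail-good : ∀ {ns ℓ} → Tail a k t ns ℓ → Good ℓ
  Tail-good (stop _) = Good-[]
  Tail-good (run ns<k τ) = Good-∷⁺ (Tail-good τ) (GoodAt-min above-ns)
    where
    above-ns : ∀ {w} → w ∈ _ → _ < w
    above-ns w∈ with ∈-Tail⁻ τ w∈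
    ... | inj₁ (ns<w , _) = ns<w
    ... | inj₂ (k<w , _)  = <-trans ns<k k<w
  Tail-good (jump {m = m} {ℓ = ℓ} _ k<m _ μ) =
    Good-∷⁺ (Merge-good (n<1+n k) (n<1+n m) μ) (fishburn ℓ μ , no-321 , no-21354)
    where
    open MergeFacts.Separated k m t k<m
    fishburn : ∀ ℓ′ → Merge k m t _ (suc k) (suc m) fresh ℓ′ → FishburnAt m ℓ′
    fishburn []      _ = tt
    fishburn (y ∷ r) μ′ m<y {w} w∈ m≡1+w with fresh-high⇒m≡1+k μ′ m<y
    ... | refl with ∈-Merge⁻ k m t μ′ w∈
    ...   | inj₁ (_ , w<k)         = <-irrefl (sym (suc-injective m≡1+w)) w<k
    ...   | inj₂ (inj₁ (k<w , _))  = <-irrefl (suc-injective m≡1+w) k<w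
    ...   | inj₂ (inj₂ (k+1<w , _)) = <-irrefl (suc-injective m≡1+w) (<-trans (n<1+n k) k+1<w)
    no-321 : ∀ {b c} → b ∷ c ∷ [] ⊆ ℓ → c < b → b < m → ⊥
    no-321 σ c<b b<m = <-asym c<b (increasing-below-m (n<1+n k) (n<1+n m) μ σ b<m (<-trans c<b b<m))
    no-21354 : ∀ {b c d e} → b ∷ c ∷ d ∷ e ∷ [] ⊆ ℓ → b < m → m < c → c < e → e < d → ⊥
    no-21354 σ _ m<c c<e e<d =
      <-asym e<d (increasing-above-m (n<1+n k) (n<1+n m) μ (∷ˡ⁻ (∷ˡ⁻ σ)) (<-trans m<c (<-trans c<e e<d)) (<-trans m<c c<e))

  Tail-head : ∀ {ℓ} → Tail a k t (suc a) ℓ → suc a < k → ∃ λ τ → ℓ ≡ suc a ∷ τ × Tail a k t (suc (suc a)) τ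
  Tail-head (stop _)             a+1<k = contradiction a+1<k (<-irrefl refl)
  Tail-head (run _ τ)            _     = _ , refl , τ
  Tail-head (jump a+1<a+1 _ _ _) _     = contradiction a+1<a+1 (<-irrefl refl)

Tail⇒Good∧IsPerm : ∀ a N k ℓ → suc a < k → k ≤ a + N → Tail a k (a + N) (suc a) ℓ → Good (k ∷ ℓ) × IsPerm a N (k ∷ ℓ)
Tail⇒Good∧IsPerm a N k ℓ a+1<k k≤t τ = Good-∷⁺ (Tail-good τ) (fishburn , no-321 , no-21354) , (k∉ℓ ∷ Tail-unique τ) , inRange , covers
  where
  open TailFacts a k (a + N)
  fishburn : FishburnAt k ℓ
  fishburn with Tail-head τ a+1<k
  ... | _ , refl , _ = λ k<a+1 → contradiction a+1<k (<-asym k<a+1)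
  no-321 : ∀ {b c} → b ∷ c ∷ [] ⊆ ℓ → c < b → b < k → ⊥
  no-321 σ c<b b<k = <-asym c<b (increasing-below-k τ σ b<k (<-trans c<b b<k))
  no-21354 : ∀ {b c d e} → b ∷ c ∷ d ∷ e ∷ [] ⊆ ℓ → b < k → k < c → c < e → e < d → ⊥
  no-21354 σ _ = no-132-above-k τ (∷ˡ⁻ σ)
  k∉ℓ : All (k ≢_) ℓ
  k∉ℓ = All.tabulate λ w∈ k≡w → case (∈-Tail⁻ τ w∈) k≡w
    where
    case : ∀ {w} → (suc a ≤ w × w < k) ⊎ (k < w × w ≤ a + N) → k ≢ w
    case (inj₁ (_ , w<k)) refl = <-irrefl refl w<k
    case (inj₂ (k<w , _)) refl = <-irrefl refl k<w
  a<k = <-trans (n<1+n a) a+1<k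
  inRange : ∀ {z} → z ∈ k ∷ ℓ → a < z × z ≤ a + N
  inRange (here refl) = a<k , k≤t
  inRange (there z∈) with ∈-Tail⁻ τ z∈
  ... | inj₁ (a<z , z<k) = a<z , ≤-trans (<⇒≤ z<k) k≤t
  ... | inj₂ (k<z , z≤t) = <-trans a<k k<z , z≤t
  covers : ∀ {z} → a < z → z ≤ a + N → z ∈ k ∷ ℓ
  covers {z} a<z z≤t with <-cmp z k
  ... | tri≈ _ refl _ = here refl
  ... | tri< z<k _ _  = there (∈-Tail⁺ τ (inj₁ (a<z , z<k)))
  ... | tri> _ _ k<z  = there (∈-Tail⁺ τ (inj₂ (k<z , z≤t)))

-- Every good permutation has that shape

record Exactly (ℓ′ : List ℕ) (P : ℕ → Set) : Set where
  field
    sound    : ∀ {z} → z ∈ ℓ′ → P z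
    complete : ∀ {z} → P z → z ∈ ℓ′
open Exactly

Exactly-∷ : ∀ {z r P Q} → Unique (z ∷ r) → Exactly (z ∷ r) P →
  (∀ {w} → Q w → P w × w ≢ z) → (∀ {w} → P w → w ≢ z → Q w) → Exactly r Q
Exactly-∷ {z} (z∉r ∷ _) ex Q⇒P P⇒Q = record
  { sound    = λ w∈ → P⇒Q (sound ex (there w∈)) (λ { refl → All.lookup z∉r w∈ refl })
  ; complete = λ Qw → let (Pw , w≢z) = Q⇒P Qw in other (complete ex Pw) w≢z }
  where
  other : ∀ {w} → w ∈ z ∷ _ → w ≢ z → w ∈ _
  other (here w≡z) w≢z = contradiction w≡z w≢z
  other (there w∈) _   = w∈

missing-in-rest : ∀ {z r P w} → Exactly (z ∷ r) P → P w → w ≢ z → w ∈ r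
missing-in-rest ex Pw w≢z with complete ex Pw
... | here w≡z = contradiction w≡z w≢z
... | there w∈ = w∈

exhausted : ∀ {P : ℕ → Set} {lo hi} → Exactly [] P → lo ≤ hi → (lo < hi → ∃ P) → lo ≡ hi
exhausted ex lo≤hi missing with m≤n⇒m<n∨m≡n lo≤hi
... | inj₂ lo≡hi = lo≡hi
... | inj₁ lo<hi with complete ex (proj₂ (missing lo<hi))
...   | ()

pred-split : ∀ {x m} → suc x ≤ m → ∃ λ m′ → m ≡ suc m′ × x ≤ m′
pred-split (s≤s x≤m′) = _ , refl , x≤m′

skip-third : ∀ {x y z : ℕ} {r ℓ} → x ∷ y ∷ z ∷ r ⊆ ℓ → x ∷ y ∷ r ⊆ ℓ
skip-third σ = ⊆-trans (refl ∷ refl ∷ (_ ∷ʳ ⊆-refl)) σ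

skip-second : ∀ {x y : ℕ} {r ℓ} → x ∷ y ∷ r ⊆ ℓ → x ∷ r ⊆ ℓ
skip-second σ = ⊆-trans (refl ∷ (_ ∷ʳ ⊆-refl)) σ

pick₂ : ∀ {z w : ℕ} {r ℓ} → z ∷ r ⊆ ℓ → w ∈ r → z ∷ w ∷ [] ⊆ ℓ
pick₂ σ w∈ = ⊆-trans (refl ∷ from∈ w∈) σ

pick₃ : ∀ {x z w : ℕ} {r ℓ} → x ∷ z ∷ r ⊆ ℓ → w ∈ r → x ∷ z ∷ w ∷ [] ⊆ ℓ
pick₃ σ w∈ = ⊆-trans (refl ∷ refl ∷ from∈ w∈) σ

pick₄ : ∀ {x y z w : ℕ} {r ℓ} → x ∷ y ∷ z ∷ r ⊆ ℓ → w ∈ r → x ∷ y ∷ z ∷ w ∷ [] ⊆ ℓ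
pick₄ σ w∈ = ⊆-trans (refl ∷ refl ∷ refl ∷ from∈ w∈) σ

module Completeness (a N k : ℕ) (ℓ : List ℕ) (good : Good (k ∷ ℓ)) (perm : IsPerm a N (k ∷ ℓ)) (a+1<k : suc a < k) where

  t : ℕ
  t = a + N

  k≤t : k ≤ t
  k≤t = proj₂ (proj₁ (proj₂ perm) (here refl))

  a<k : a < k
  a<k = <-trans (n<1+n a) a+1<k

  no-321 : ∀ {x y w} → x ∷ y ∷ w ∷ [] ⊆ k ∷ ℓ → w < y → y < x → ⊥
  no-321 = proj₁ (proj₂ good)

  no-21354 : ∀ {x z w} → suc a ∷ x ∷ z ∷ w ∷ [] ⊆ ℓ → k < x → x < w → w < z → ⊥
  no-21354 σ = proj₂ (proj₂ good) (refl ∷ σ) a+1<k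

  module AfterJump (m : ℕ) (k<m : k < m) (m≤t : m ≤ t) where
    open MergeFacts k m t using (Remaining)

    -- ℓ′ is the part of ℓ still to be read.  The entries a + 1 and m, and k + 1
    -- once placed, occur before it: they complete the forbidden patterns below.
    record MergeInv (ns nl ny : ℕ) (ph : Phase) (ℓ′ : List ℕ) : Set where
      field
        ns≤k       : ns ≤ k
        k<nl       : k < nl
        nl≤m       : nl ≤ m
        m<ny       : m < ny
        ny≤1+t     : ny ≤ suc t
        exact      : Exactly ℓ′ (Remaining ns nl ny)
        unique     : Unique ℓ′
        after-m    : suc a ∷ m ∷ ℓ′ ⊆ ℓ
        after-k+1  : suc k < nl → suc a ∷ suc k ∷ ℓ′ ⊆ ℓ
        fresh-info : ph ≡ fresh → nl ≡ suc k × FishburnAt m ℓ′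
    open MergeInv

    next-low : ∀ {ns nl ny ph z r} → MergeInv ns nl ny ph (z ∷ r) → ns ≤ z → z < k → z ≡ ns
    next-low {ns} inv ns≤z z<k with m≤n⇒m<n∨m≡n ns≤z
    ... | inj₂ ns≡z = sym ns≡z
    ... | inj₁ ns<z = ⊥-elim (no-321 (refl ∷ pick₂ (∷ˡ⁻ (∷ˡ⁻ (after-m inv))) ns∈r) ns<z z<k)
      where
      ns∈r = missing-in-rest (exact inv) (inj₁ (≤-refl , <-trans ns<z z<k)) (<⇒≢ ns<z)

    next-mid : ∀ {ns nl ny ph z r} → MergeInv ns nl ny ph (z ∷ r) → nl ≤ z → z < m → ns ≡ k × z ≡ nl
    next-mid {ns} {nl} {z = z} {r} inv nl≤z z<m = low-exhausted , mid-next
      where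
      321-with-m : ∀ {w} → w ∈ r → w < z → ⊥
      321-with-m w∈ w<z = no-321 (_ ∷ʳ pick₃ (∷ˡ⁻ (after-m inv)) w∈) w<z z<m
      low-exhausted : ns ≡ k
      low-exhausted with m≤n⇒m<n∨m≡n (ns≤k inv)
      ... | inj₂ ns≡k = ns≡k
      ... | inj₁ ns<k = ⊥-elim (321-with-m ns∈r ns<z)
        where
        ns<z = <-trans ns<k (<-≤-trans (k<nl inv) nl≤z)
        ns∈r = missing-in-rest (exact inv) (inj₁ (≤-refl , ns<k)) (<⇒≢ ns<z)
      mid-next : z ≡ nl
      mid-next with m≤n⇒m<n∨m≡n nl≤z
      ... | inj₂ nl≡z = sym nl≡z
      ... | inj₁ nl<z = ⊥-elim (321-with-m nl∈r nl<z)
        where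
        nl∈r = missing-in-rest (exact inv) (inj₂ (inj₁ (≤-refl , <-trans nl<z z<m))) (<⇒≢ nl<z)

    next-high-value : ∀ {ns nl ny ph z r} → MergeInv ns nl ny ph (z ∷ r) → ny ≤ z → z ≤ t → z ≡ ny
    next-high-value {ny = ny} inv ny≤z z≤t with m≤n⇒m<n∨m≡n ny≤z
    ... | inj₂ ny≡z = sym ny≡z
    ... | inj₁ ny<z = ⊥-elim (no-21354 (pick₄ (after-m inv) ny∈r) k<m (m<ny inv) ny<z)
      where
      ny∈r = missing-in-rest (exact inv) (inj₂ (inj₂ (≤-refl , ≤-trans (<⇒≤ ny<z) z≤t))) (<⇒≢ ny<z)

    next-high-allowed : ∀ {ns nl ny ph z r} → MergeInv ns nl ny ph (z ∷ r) → m < z → HighOK k m ph nl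
    next-high-allowed {nl = nl} {ph = fresh} inv m<z with fresh-info inv refl
    ... | refl , fishburn with m≤n⇒m<n∨m≡n k<m
    ...   | inj₂ 1+k≡m = sym 1+k≡m
    ...   | inj₁ 1+k<m with pred-split 1+k<m
    ...     | m′ , m≡1+m′ , 1+k≤m′ =
      ⊥-elim (fishburn m<z (complete (exact inv) (inj₂ (inj₁ (1+k≤m′ , subst (m′ <_) (sym m≡1+m′) (n<1+n m′))))) m≡1+m′)
    next-high-allowed {nl = nl} {ph = settled} inv m<z with nl ≟ suc k | nl ≟ m
    ... | yes nl≡1+k | _       = inj₁ nl≡1+k
    ... | no  _      | yes nl≡m = inj₂ nl≡m
    ... | no  nl≢1+k | no nl≢m = ⊥-elim (no-21354 (pick₄ (after-k+1 inv 1+k<nl) nl∈r) (n<1+n k) 1+k<nl nl<z)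
      where
      1+k<nl = ≤∧≢⇒< (k<nl inv) (nl≢1+k ∘ sym)
      nl<m   = ≤∧≢⇒< (nl≤m inv) nl≢m
      nl<z   = <-trans nl<m m<z
      nl∈r   = missing-in-rest (exact inv) (inj₂ (inj₁ (≤-refl , nl<m))) (<⇒≢ nl<z)

    inv-low : ∀ {ns nl ny ph r} → MergeInv ns nl ny ph (ns ∷ r) → ns < k → MergeInv (suc ns) nl ny settled r
    inv-low {ns} inv ns<k = record
      { ns≤k = ns<k ; k<nl = k<nl inv ; nl≤m = nl≤m inv ; m<ny = m<ny inv ; ny≤1+t = ny≤1+t inv
      ; exact = Exactly-∷ (unique inv) (exact inv) shrink grow
      ; unique = Unique-tail (unique inv)
      ; after-m = skip-third (after-m inv) ; after-k+1 = skip-third ∘ after-k+1 inv ; fresh-info = λ () }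
      where
      above-ns : ∀ {w} → k ≤ w → w ≢ ns
      above-ns k≤w refl = <⇒≱ ns<k k≤w
      shrink : ∀ {w} → Remaining (suc ns) _ _ w → Remaining ns _ _ w × w ≢ ns
      shrink (inj₁ (ns<w , w<k))      = inj₁ (<⇒≤ ns<w , w<k) , >⇒≢ ns<w
      shrink (inj₂ (inj₁ (nl≤w , w<m))) = inj₂ (inj₁ (nl≤w , w<m)) , above-ns (<⇒≤ (<-≤-trans (k<nl inv) nl≤w))
      shrink (inj₂ (inj₂ (ny≤w , w≤t))) = inj₂ (inj₂ (ny≤w , w≤t)) , above-ns (<⇒≤ (<-trans k<m (<-≤-trans (m<ny inv) ny≤w)))
      grow : ∀ {w} → Remaining ns _ _ w → w ≢ ns → Remaining (suc ns) _ _ w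
      grow (inj₁ (ns≤w , w<k)) w≢ns = inj₁ (≤∧≢⇒< ns≤w (w≢ns ∘ sym) , w<k)
      grow (inj₂ rest)         _    = inj₂ rest

    inv-mid : ∀ {nl ny ph r} → MergeInv k nl ny ph (nl ∷ r) → nl < m → MergeInv k (suc nl) ny settled r
    inv-mid {nl} {r = r} inv nl<m = record
      { ns≤k = ≤-refl ; k<nl = <-trans (k<nl inv) (n<1+n nl) ; nl≤m = nl<m ; m<ny = m<ny inv ; ny≤1+t = ny≤1+t inv
      ; exact = Exactly-∷ (unique inv) (exact inv) shrink grow
      ; unique = Unique-tail (unique inv)
      ; after-m = skip-third (after-m inv) ; after-k+1 = after-k+1′ ; fresh-info = λ () }
      where
      after-k+1′ : suc k < suc nl → suc a ∷ suc k ∷ r ⊆ ℓ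
      after-k+1′ (s≤s 1+k≤nl) with m≤n⇒m<n∨m≡n 1+k≤nl
      ... | inj₁ 1+k<nl = skip-third (after-k+1 inv 1+k<nl)
      ... | inj₂ refl   = ⊆-trans (refl ∷ (_ ∷ʳ ⊆-refl)) (after-m inv)
      shrink : ∀ {w} → Remaining k (suc nl) _ w → Remaining k nl _ w × w ≢ nl
      shrink (inj₁ (k≤w , w<k))          = contradiction (<-≤-trans w<k k≤w) (<-irrefl refl)
      shrink (inj₂ (inj₁ (nl<w , w<m)))  = inj₂ (inj₁ (<⇒≤ nl<w , w<m)) , >⇒≢ nl<w
      shrink (inj₂ (inj₂ (ny≤w , w≤t)))  = inj₂ (inj₂ (ny≤w , w≤t)) , >⇒≢ (<-trans nl<m (<-≤-trans (m<ny inv) ny≤w))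
      grow : ∀ {w} → Remaining k nl _ w → w ≢ nl → Remaining k (suc nl) _ w
      grow (inj₁ r₁)                  _    = inj₁ r₁
      grow (inj₂ (inj₁ (nl≤w , w<m))) w≢nl = inj₂ (inj₁ (≤∧≢⇒< nl≤w (w≢nl ∘ sym) , w<m))
      grow (inj₂ (inj₂ r₃))           _    = inj₂ (inj₂ r₃)

    inv-high : ∀ {ns nl ny ph r} → MergeInv ns nl ny ph (ny ∷ r) → ny ≤ t → MergeInv ns nl (suc ny) settled r
    inv-high {ny = ny} inv ny≤t = record
      { ns≤k = ns≤k inv ; k<nl = k<nl inv ; nl≤m = nl≤m inv ; m<ny = <-trans (m<ny inv) (n<1+n ny) ; ny≤1+t = s≤s ny≤t
      ; exact = Exactly-∷ (unique inv) (exact inv) shrink grow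
      ; unique = Unique-tail (unique inv)
      ; after-m = skip-third (after-m inv) ; after-k+1 = skip-third ∘ after-k+1 inv ; fresh-info = λ () }
      where
      below-ny : ∀ {w} → w < m → w ≢ ny
      below-ny w<m refl = <-asym w<m (m<ny inv)
      shrink : ∀ {w} → Remaining _ _ (suc ny) w → Remaining _ _ ny w × w ≢ ny
      shrink (inj₁ (ns≤w , w<k))        = inj₁ (ns≤w , w<k) , below-ny (<-trans w<k k<m)
      shrink (inj₂ (inj₁ (nl≤w , w<m))) = inj₂ (inj₁ (nl≤w , w<m)) , below-ny w<m
      shrink (inj₂ (inj₂ (ny<w , w≤t))) = inj₂ (inj₂ (<⇒≤ ny<w , w≤t)) , >⇒≢ ny<w
      grow : ∀ {w} → Remaining _ _ ny w → w ≢ ny → Remaining _ _ (suc ny) w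
      grow (inj₁ r₁)                  _    = inj₁ r₁
      grow (inj₂ (inj₁ r₂))           _    = inj₂ (inj₁ r₂)
      grow (inj₂ (inj₂ (ny≤w , w≤t))) w≢ny = inj₂ (inj₂ (≤∧≢⇒< ny≤w (w≢ny ∘ sym) , w≤t))

    toMerge : ∀ {ns nl ny ph ℓ′} → MergeInv ns nl ny ph ℓ′ → Merge k m t ns nl ny ph ℓ′
    toMerge {ns} {nl} {ny} {ℓ′ = []} inv
      rewrite exhausted (exact inv) (ns≤k inv)   (λ ns<k → _ , inj₁ (≤-refl , ns<k))
            | exhausted (exact inv) (nl≤m inv)   (λ nl<m → _ , inj₂ (inj₁ (≤-refl , nl<m)))
            | exhausted (exact inv) (ny≤1+t inv) (λ { (s≤s ny≤t) → _ , inj₂ (inj₂ (≤-refl , ny≤t)) }) = done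
    toMerge {ℓ′ = z ∷ r} inv with sound (exact inv) (here refl)
    ... | inj₁ (ns≤z , z<k) with next-low inv ns≤z z<k
    ...   | refl = low z<k (toMerge (inv-low inv z<k))
    toMerge {ℓ′ = z ∷ r} inv | inj₂ (inj₁ (nl≤z , z<m)) with next-mid inv nl≤z z<m
    ...   | refl , refl = mid z<m (toMerge (inv-mid inv z<m))
    toMerge {ℓ′ = z ∷ r} inv | inj₂ (inj₂ (ny≤z , z≤t)) with next-high-value inv ny≤z z≤t
    ...   | refl = high z≤t (next-high-allowed inv (<-≤-trans (m<ny inv) ny≤z)) (toMerge (inv-high inv z≤t))

  TailRange : ℕ → ℕ → Set
  TailRange ns z = (ns ≤ z × z < k) ⊎ (k < z × z ≤ t)

  record TailInv (ns : ℕ) (ℓ′ : List ℕ) : Set where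
    field
      a+1<ns    : suc a < ns
      ns≤k      : ns ≤ k
      exact     : Exactly ℓ′ (TailRange ns)
      unique    : Unique ℓ′
      after-a+1 : suc a ∷ ℓ′ ⊆ ℓ
      fishburn  : Fishburn ℓ′
  open TailInv

  next-run : ∀ {ns z r} → TailInv ns (z ∷ r) → ns ≤ z → z < k → z ≡ ns
  next-run inv ns≤z z<k with m≤n⇒m<n∨m≡n ns≤z
  ... | inj₂ ns≡z = sym ns≡z
  ... | inj₁ ns<z = ⊥-elim (no-321 (refl ∷ pick₂ (∷ˡ⁻ (after-a+1 inv)) ns∈r) ns<z z<k)
    where
    ns∈r = missing-in-rest (exact inv) (inj₁ (≤-refl , <-trans ns<z z<k)) (<⇒≢ ns<z)

  inv-run : ∀ {ns r} → TailInv ns (ns ∷ r) → ns < k → TailInv (suc ns) r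
  inv-run {ns} {r} inv ns<k = record
    { a+1<ns = <-trans (a+1<ns inv) (n<1+n ns) ; ns≤k = ns<k
    ; exact = Exactly-∷ (unique inv) (exact inv) shrink grow
    ; unique = Unique-tail (unique inv)
    ; after-a+1 = skip-second (after-a+1 inv) ; fishburn = proj₁ (Fishburn-∷⁻ {ns} {r} (fishburn inv)) }
    where
    shrink : ∀ {w} → TailRange (suc ns) w → TailRange ns w × w ≢ ns
    shrink (inj₁ (ns<w , w<k)) = inj₁ (<⇒≤ ns<w , w<k) , >⇒≢ ns<w
    shrink (inj₂ (k<w , w≤t))  = inj₂ (k<w , w≤t) , >⇒≢ (<-trans ns<k k<w)
    grow : ∀ {w} → TailRange ns w → w ≢ ns → TailRange (suc ns) w
    grow (inj₁ (ns≤w , w<k)) w≢ns = inj₁ (≤∧≢⇒< ns≤w (w≢ns ∘ sym) , w<k)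
    grow (inj₂ above)         _   = inj₂ above

  inv-jump : ∀ {ns m r} → TailInv ns (m ∷ r) → (k<m : k < m) (m≤t : m ≤ t) →
    AfterJump.MergeInv m k<m m≤t ns (suc k) (suc m) fresh r
  inv-jump {ns} {m} {r} inv k<m m≤t = record
    { ns≤k = ns≤k inv ; k<nl = n<1+n k ; nl≤m = k<m ; m<ny = n<1+n m ; ny≤1+t = s≤s m≤t
    ; exact = Exactly-∷ (unique inv) (exact inv) shrink grow
    ; unique = Unique-tail (unique inv)
    ; after-m = after-a+1 inv ; after-k+1 = λ 1+k<1+k → contradiction 1+k<1+k (<-irrefl refl)
    ; fresh-info = λ _ → refl , proj₂ (Fishburn-∷⁻ {m} {r} (fishburn inv)) }
    where
    open MergeFacts k m t using (Remaining)
    shrink : ∀ {w} → Remaining ns (suc k) (suc m) w → TailRange ns w × w ≢ m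
    shrink (inj₁ (ns≤w , w<k))        = inj₁ (ns≤w , w<k) , <⇒≢ (<-trans w<k k<m)
    shrink (inj₂ (inj₁ (k<w , w<m)))  = inj₂ (k<w , ≤-trans (<⇒≤ w<m) m≤t) , <⇒≢ w<m
    shrink (inj₂ (inj₂ (m<w , w≤t)))  = inj₂ (<-trans k<m (<-≤-trans (n<1+n m) m<w) , w≤t) , >⇒≢ m<w
    grow : ∀ {w} → TailRange ns w → w ≢ m → Remaining ns (suc k) (suc m) w
    grow (inj₁ below)       _   = inj₁ below
    grow {w} (inj₂ (k<w , w≤t)) w≢m with <-cmp w m
    ... | tri< w<m _ _   = inj₂ (inj₁ (k<w , w<m))
    ... | tri≈ _ w≡m _   = contradiction w≡m w≢m
    ... | tri> _ _ m<w   = inj₂ (inj₂ (m<w , w≤t))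

  toTail : ∀ {ns ℓ′} → TailInv ns ℓ′ → Tail a k t ns ℓ′
  toTail {ns} {[]} inv
    rewrite exhausted (exact inv) (ns≤k inv) (λ ns<k → _ , inj₁ (≤-refl , ns<k)) =
    stop (exhausted (exact inv) k≤t (λ k<t → _ , inj₂ (k<t , ≤-refl)))
  toTail {ℓ′ = z ∷ r} inv with sound (exact inv) (here refl)
  ... | inj₁ (ns≤z , z<k) with next-run inv ns≤z z<k
  ...   | refl = run z<k (toTail (inv-run inv z<k))
  toTail {ℓ′ = z ∷ r} inv | inj₂ (k<z , z≤t) =
    jump (a+1<ns inv) k<z z≤t (AfterJump.toMerge z k<z z≤t (inv-jump inv k<z z≤t))

  k∉ℓ : ∀ {w} → w ∈ ℓ → w ≢ k
  k∉ℓ w∈ w≡k = All.lookup (Unique-head (proj₁ perm)) w∈ (sym w≡k)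

  ∈ℓ⁺ : ∀ {w} → a < w → w ≤ t → w ≢ k → w ∈ ℓ
  ∈ℓ⁺ a<w w≤t w≢k with proj₂ (proj₂ perm) a<w w≤t
  ... | here w≡k = contradiction w≡k w≢k
  ... | there w∈ = w∈

  starts-with-a+1 : ∃ λ ℓ₀ → ℓ ≡ suc a ∷ ℓ₀
  starts-with-a+1 = first ℓ refl (∈ℓ⁺ (n<1+n a) (≤-trans (<⇒≤ a+1<k) k≤t) (<⇒≢ a+1<k)) (∈ℓ⁺ a<k′ k′≤t (<⇒≢ k′<k))
    where
    k′ = proj₁ (pred-split a+1<k)
    k≡1+k′ = proj₁ (proj₂ (pred-split a+1<k))
    a<k′ = proj₂ (proj₂ (pred-split a+1<k))
    k′<k = subst (k′ <_) (sym k≡1+k′) (n<1+n k′)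
    k′≤t = ≤-trans (<⇒≤ k′<k) k≤t
    first : ∀ ℓ′ → ℓ′ ≡ ℓ → suc a ∈ ℓ′ → k′ ∈ ℓ′ → ∃ λ ℓ₀ → ℓ′ ≡ suc a ∷ ℓ₀
    first (y ∷ r) refl a+1∈ k′∈ with <-cmp y k
    ... | tri≈ _ y≡k _ = contradiction y≡k (k∉ℓ (here refl))
    ... | tri> _ _ k<y = ⊥-elim (proj₁ (proj₂ (Good-∷⁻ good)) k<y k′∈ k≡1+k′)
    ... | tri< y<k _ _ with y ≟ suc a | a+1∈
    ...   | yes refl | _          = r , refl
    ...   | no y≢a+1 | here a+1≡y = contradiction (sym a+1≡y) y≢a+1
    ...   | no y≢a+1 | there a+1∈r =
      ⊥-elim (no-321 (refl ∷ refl ∷ from∈ a+1∈r) (≤∧≢⇒< (proj₁ (proj₁ (proj₂ perm) (there (here refl)))) (y≢a+1 ∘ sym)) y<k)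

  initial-TailInv : ∀ ℓ₀ → ℓ ≡ suc a ∷ ℓ₀ → TailInv (suc (suc a)) ℓ₀
  initial-TailInv ℓ₀ refl = record
    { a+1<ns = n<1+n (suc a) ; ns≤k = a+1<k
    ; exact = record { sound = sound′ ; complete = complete′ }
    ; unique = Unique-tail (Unique-tail (proj₁ perm))
    ; after-a+1 = ⊆-refl
    ; fishburn = proj₁ (Fishburn-∷⁻ {suc a} {ℓ₀} (proj₁ (proj₁ (Good-∷⁻ good)))) }
    where
    inRange : ∀ {w} → w ∈ ℓ₀ → a < w × w ≤ t
    inRange w∈ = proj₁ (proj₂ perm) (there (there w∈))
    a+1∉ℓ₀ : ∀ {w} → w ∈ ℓ₀ → w ≢ suc a
    a+1∉ℓ₀ w∈ w≡a+1 = All.lookup (Unique-head (Unique-tail (proj₁ perm))) w∈ (sym w≡a+1)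
    sound′ : ∀ {w} → w ∈ ℓ₀ → TailRange (suc (suc a)) w
    sound′ {w} w∈ with <-cmp w k
    ... | tri< w<k _ _ = inj₁ (≤∧≢⇒< (proj₁ (inRange w∈)) (a+1∉ℓ₀ w∈ ∘ sym) , w<k)
    ... | tri≈ _ w≡k _ = contradiction w≡k (k∉ℓ (there w∈))
    ... | tri> _ _ k<w = inj₂ (k<w , proj₂ (inRange w∈))
    bounds : ∀ {w} → TailRange (suc (suc a)) w → suc a < w × w ≤ t × w ≢ k
    bounds (inj₁ (a+1<w , w<k)) = a+1<w , ≤-trans (<⇒≤ w<k) k≤t , <⇒≢ w<k
    bounds (inj₂ (k<w , w≤t))   = <-trans a+1<k k<w , w≤t , >⇒≢ k<w
    complete′ : ∀ {w} → TailRange (suc (suc a)) w → w ∈ ℓ₀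
    complete′ range with bounds range
    ... | a+1<w , w≤t , w≢k with ∈ℓ⁺ (<-trans (n<1+n a) a+1<w) w≤t w≢k
    ...   | here w≡a+1 = contradiction w≡a+1 (>⇒≢ a+1<w)
    ...   | there w∈   = w∈

  Good∧IsPerm⇒Tail : Tail a k t (suc a) ℓ
  Good∧IsPerm⇒Tail with starts-with-a+1
  ... | ℓ₀ , ℓ≡ = subst (Tail a k t (suc a)) (sym ℓ≡) (run a+1<k (toTail (initial-TailInv ℓ₀ ℓ≡)))

-- Enumerating the shapes

when : {A X : Set} → Dec A → List X → List X
when (yes _) xs = xs
when (no _)  _  = []

∈-when⁻ : ∀ {A X : Set} {d : Dec A} {xs : List X} {x} → x ∈ when d xs → A × x ∈ xs
∈-when⁻ {d = yes a} x∈ = a , x∈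

∈-when⁺ : ∀ {A X : Set} (d : Dec A) {xs : List X} {x} → A → x ∈ xs → x ∈ when d xs
∈-when⁺ (yes _) _ x∈ = x∈
∈-when⁺ (no ¬a) a _  = contradiction a ¬a

when-yes : ∀ {A X : Set} (d : Dec A) {xs : List X} → A → when d xs ≡ xs
when-yes (yes _) _ = refl
when-yes (no ¬a) a = contradiction a ¬a

when-no : ∀ {A X : Set} (d : Dec A) {xs : List X} → ¬ A → when d xs ≡ []
when-no (yes a) ¬a = contradiction a ¬a
when-no (no _)  _  = refl

-- The count-indexed analogue of HighOK, for a middle run of l₀ values of which
-- l remain.
HighAllowed : ℕ → Phase → ℕ → Set
HighAllowed l₀ fresh   l = l ≡ 0
HighAllowed l₀ settled l = l ≡ l₀ ⊎ l ≡ 0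

highAllowed? : ∀ l₀ ph l → Dec (HighAllowed l₀ ph l)
highAllowed? l₀ fresh   l = l ≟ 0
highAllowed? l₀ settled l = (l ≟ l₀) ⊎-dec (l ≟ 0)

-- merges l₀ s l y ns nl ny ph lists the Merge lists with s low values from ns,
-- l middle values from nl and y high values from ny.
mutual
  merges : (l₀ s l y ns nl ny : ℕ) → Phase → List (List ℕ)
  merges l₀ zero    zero    zero    ns nl ny ph = [ [] ]
  merges l₀ (suc s) l       y       ns nl ny ph =
    map (ns ∷_) (merges l₀ s l y (suc ns) nl ny settled) ++ highFirst l₀ (suc s) l y ns nl ny ph
  merges l₀ zero    (suc l) y       ns nl ny ph =
    map (nl ∷_) (merges l₀ zero l y ns (suc nl) ny settled) ++ highFirst l₀ zero (suc l) y ns nl ny ph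
  merges l₀ zero    zero    (suc y) ns nl ny ph = highFirst l₀ zero zero (suc y) ns nl ny ph

  highFirst : (l₀ s l y ns nl ny : ℕ) → Phase → List (List ℕ)
  highFirst l₀ s l zero    ns nl ny ph = []
  highFirst l₀ s l (suc y) ns nl ny ph =
    when (highAllowed? l₀ ph l) (map (ny ∷_) (merges l₀ s l y ns nl (suc ny) settled))

-- The jumps to m = k + 1 + q, …, k + 1 + q + y, each followed by a merge with
-- s low values left and the high values m + 1, …, k + 1 + q + y.
jumps : (s q y ns k : ℕ) → List (List ℕ)
jumps s q zero    ns k = map (suc k + q ∷_) (merges q s q zero ns (suc k) (suc (suc k + q)) fresh)
jumps s q (suc y) ns k =
  map (suc k + q ∷_) (merges q s q (suc y) ns (suc k) (suc (suc k + q)) fresh) ++ jumps s (suc q) y ns k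

-- The Tail lists with r low values left from ns and h values above k.
tails : (r h ns k : ℕ) → List (List ℕ)
tails zero    zero    ns k = [ [] ]
tails (suc r) zero    ns k = map (ns ∷_) (tails r zero (suc ns) k)
tails zero    (suc h) ns k = jumps zero 0 h ns k
tails (suc r) (suc h) ns k = map (ns ∷_) (tails r (suc h) (suc ns) k) ++ jumps (suc r) 0 h ns k

-- The good permutations of a < z ≤ a + i + h + 2 that start with k = a + 2 + i.
startingAt : (a i h : ℕ) → List (List ℕ)
startingAt a i h = map (λ τ → suc (suc a) + i ∷ suc a ∷ τ) (tails i h (suc (suc a)) (suc (suc a) + i))

startingFrom : (a i h : ℕ) → List (List ℕ)
startingFrom a i zero    = startingAt a i zero
startingFrom a i (suc h) = startingAt a i (suc h) ++ startingFrom a (suc i) h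

goodPerms : ℕ → ℕ → List (List ℕ)
goodPerms a zero          = [ [] ]
goodPerms a (suc zero)    = map (suc a ∷_) (goodPerms (suc a) zero)
goodPerms a (suc (suc n)) = map (suc a ∷_) (goodPerms (suc a) (suc n)) ++ startingFrom a 0 n

-- The enumerations are duplicate-free

HeadsIn : (ℕ → Set) → List (List ℕ) → Set
HeadsIn P L = ∀ {v} → v ∈ L → ∃₂ λ x r → v ≡ x ∷ r × P x

HeadsIn-map∷ : ∀ {P : ℕ → Set} {x} L → P x → HeadsIn P (map (x ∷_) L)
HeadsIn-map∷ L px v∈ with ∈-map⁻ _ v∈
... | r , _ , refl = _ , r , refl , px

HeadsIn-++ : ∀ {P : ℕ → Set} {A B} → HeadsIn P A → HeadsIn P B → HeadsIn P (A ++ B)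
HeadsIn-++ {A = A} hA hB v∈ with ∈-++⁻ A v∈
... | inj₁ v∈A = hA v∈A
... | inj₂ v∈B = hB v∈B

HeadsIn-when : ∀ {P : ℕ → Set} {Q : Set} {L} (d : Dec Q) → HeadsIn P L → HeadsIn P (when d L)
HeadsIn-when (yes _) hL = hL
HeadsIn-when (no _)  _  ()

HeadsIn-mono : ∀ {P Q : ℕ → Set} {L} → (∀ {x} → P x → Q x) → HeadsIn P L → HeadsIn Q L
HeadsIn-mono P⇒Q hL v∈ with hL v∈
... | x , r , v≡ , px = x , r , v≡ , P⇒Q px

map∷-heads : ∀ x L → HeadsIn (_≡ x) (map (x ∷_) L)
map∷-heads x L = HeadsIn-map∷ L refl

disjoint-heads : ∀ {P Q : ℕ → Set} {A B} → HeadsIn P A → HeadsIn Q B → (∀ {x} → P x → Q x → ⊥) → Disjoint A B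
disjoint-heads hA hB P∩Q (v∈A , v∈B) with hA v∈A | hB v∈B
... | x , r , refl , px | .x , .r , refl , qx = P∩Q px qx

map∷-unique : ∀ {A : Set} {x : A} {L} → Unique L → Unique (map (x ∷_) L)
map∷-unique = map⁺ ∷-injectiveʳ

when-unique : ∀ {Q A : Set} {L : List A} (d : Dec Q) → Unique L → Unique (when d L)
when-unique (yes _) u = u
when-unique (no _)  _ = []

HeadsIn-highFirst : ∀ l₀ s l y ns nl ny ph → HeadsIn (_≡ ny) (highFirst l₀ s l y ns nl ny ph)
HeadsIn-highFirst l₀ s l zero    ns nl ny ph ()
HeadsIn-highFirst l₀ s l (suc y) ns nl ny ph = HeadsIn-when (highAllowed? l₀ ph l) (map∷-heads ny _)

mutual
  merges-unique : ∀ l₀ s l y ns nl ny ph → ns + s ≤ ny → nl + l ≤ ny → Unique (merges l₀ s l y ns nl ny ph)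
  merges-unique l₀ zero    zero    zero    ns nl ny ph _ _ = [] ∷ []
  merges-unique l₀ (suc s) l       y       ns nl ny ph lo mi =
    ++⁺ (map∷-unique (merges-unique l₀ s l y (suc ns) nl ny settled (subst (_≤ ny) (+-suc ns s) lo) mi))
        (highFirst-unique l₀ (suc s) l y ns nl ny ph lo mi)
        (disjoint-heads (map∷-heads ns _) (HeadsIn-highFirst l₀ (suc s) l y ns nl ny ph)
          λ { refl refl → <-irrefl refl (<-≤-trans (m<m+n ns (s≤s z≤n)) lo) })
  merges-unique l₀ zero    (suc l) y       ns nl ny ph lo mi =
    ++⁺ (map∷-unique (merges-unique l₀ zero l y ns (suc nl) ny settled lo (subst (_≤ ny) (+-suc nl l) mi)))
        (highFirst-unique l₀ zero (suc l) y ns nl ny ph lo mi)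
        (disjoint-heads (map∷-heads nl _) (HeadsIn-highFirst l₀ zero (suc l) y ns nl ny ph)
          λ { refl refl → <-irrefl refl (<-≤-trans (m<m+n nl (s≤s z≤n)) mi) })
  merges-unique l₀ zero    zero    (suc y) ns nl ny ph lo mi = highFirst-unique l₀ zero zero (suc y) ns nl ny ph lo mi

  highFirst-unique : ∀ l₀ s l y ns nl ny ph → ns + s ≤ ny → nl + l ≤ ny → Unique (highFirst l₀ s l y ns nl ny ph)
  highFirst-unique l₀ s l zero    ns nl ny ph _  _  = []
  highFirst-unique l₀ s l (suc y) ns nl ny ph lo mi = when-unique (highAllowed? l₀ ph l)
    (map∷-unique (merges-unique l₀ s l y ns nl (suc ny) settled (≤-trans lo (n≤1+n ny)) (≤-trans mi (n≤1+n ny))))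

HeadsIn-jumps : ∀ s q y ns k → HeadsIn (suc k + q ≤_) (jumps s q y ns k)
HeadsIn-jumps s q zero    ns k = HeadsIn-map∷ _ ≤-refl
HeadsIn-jumps s q (suc y) ns k = HeadsIn-++ (HeadsIn-map∷ _ ≤-refl)
  (HeadsIn-mono (≤-trans (+-monoʳ-≤ (suc k) (n≤1+n q))) (HeadsIn-jumps s (suc q) y ns k))

jumps-unique : ∀ s q y ns k → ns + s ≤ k → Unique (jumps s q y ns k)
jumps-unique s q y ns k lo = go q y
  where
  merges-after : ∀ q y → Unique (merges q s q y ns (suc k) (suc (suc k + q)) fresh)
  merges-after q y = merges-unique q s q y ns (suc k) _ fresh
    (≤-trans lo (≤-trans (n≤1+n k) (≤-trans (m≤m+n (suc k) q) (n≤1+n _)))) (n≤1+n _)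
  go : ∀ q y → Unique (jumps s q y ns k)
  go q zero    = map∷-unique (merges-after q zero)
  go q (suc y) = ++⁺ (map∷-unique (merges-after q (suc y))) (go (suc q) y)
    (disjoint-heads (map∷-heads (suc k + q) _) (HeadsIn-jumps s (suc q) y ns k)
      λ { refl le → <-irrefl refl (<-≤-trans (+-monoʳ-< (suc k) (n<1+n q)) le) })

tails-unique : ∀ r h ns k → ns + r ≤ k → Unique (tails r h ns k)
tails-unique zero    zero    ns k lo = [] ∷ []
tails-unique (suc r) zero    ns k lo = map∷-unique (tails-unique r zero (suc ns) k (subst (_≤ k) (+-suc ns r) lo))
tails-unique zero    (suc h) ns k lo = jumps-unique zero 0 h ns k lo
tails-unique (suc r) (suc h) ns k lo =
  ++⁺ (map∷-unique (tails-unique r (suc h) (suc ns) k (subst (_≤ k) (+-suc ns r) lo))) (jumps-unique (suc r) 0 h ns k lo)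
      (disjoint-heads (map∷-heads ns _) (HeadsIn-jumps (suc r) 0 h ns k)
        λ { refl k+1+0≤ns → <-asym (<-≤-trans (m<m+n ns (s≤s z≤n)) lo) (subst (_≤ ns) (cong suc (+-identityʳ k)) k+1+0≤ns) })

HeadsIn-startingAt : ∀ a i h → HeadsIn (_≡ suc (suc a) + i) (startingAt a i h)
HeadsIn-startingAt a i h v∈ with ∈-map⁻ _ v∈
... | τ , _ , refl = _ , _ , refl , refl

startingAt-unique : ∀ a i h → Unique (startingAt a i h)
startingAt-unique a i h = map⁺ (∷-injectiveʳ ∘ ∷-injectiveʳ) (tails-unique i h (suc (suc a)) _ ≤-refl)

HeadsIn-startingFrom : ∀ a i h → HeadsIn (suc (suc a) + i ≤_) (startingFrom a i h)
HeadsIn-startingFrom a i zero    = HeadsIn-mono (λ e → ≤-reflexive (sym e)) (HeadsIn-startingAt a i zero)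
HeadsIn-startingFrom a i (suc h) = HeadsIn-++ (HeadsIn-mono (λ e → ≤-reflexive (sym e)) (HeadsIn-startingAt a i (suc h)))
  (HeadsIn-mono (≤-trans (+-monoʳ-≤ (suc (suc a)) (n≤1+n i))) (HeadsIn-startingFrom a (suc i) h))

startingFrom-unique : ∀ a i h → Unique (startingFrom a i h)
startingFrom-unique a i zero    = startingAt-unique a i zero
startingFrom-unique a i (suc h) = ++⁺ (startingAt-unique a i (suc h)) (startingFrom-unique a (suc i) h)
  (disjoint-heads (HeadsIn-startingAt a i (suc h)) (HeadsIn-startingFrom a (suc i) h)
    λ { refl le → <-irrefl refl (<-≤-trans (+-monoʳ-< (suc (suc a)) (n<1+n i)) le) })

goodPerms-unique : ∀ a n → Unique (goodPerms a n)
goodPerms-unique a zero          = [] ∷ []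
goodPerms-unique a (suc zero)    = map∷-unique (goodPerms-unique (suc a) zero)
goodPerms-unique a (suc (suc n)) = ++⁺ (map∷-unique (goodPerms-unique (suc a) (suc n))) (startingFrom-unique a 0 n)
  (disjoint-heads (map∷-heads (suc a) _) (HeadsIn-startingFrom a 0 n)
    λ { refl a+2+0≤a+1 → <-irrefl refl (<-≤-trans (m≤m+n (suc (suc a)) 0) a+2+0≤a+1) })

words-unique : ∀ k xs → Unique xs → Unique (words k xs)
words-unique zero    xs u = [] ∷ []
words-unique (suc k) xs u = go xs u
  where
  go : ∀ ys → Unique ys → Unique (concatMap (λ x → map (x ∷_) (words k xs)) ys)
  go []       _           = []
  go (y ∷ ys) (y∉ys ∷ u′) = ++⁺ (map∷-unique (words-unique k xs u)) (go ys u′)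
    (disjoint-heads (map∷-heads y _) (heads ys)
      λ { refl y∈ys → All.lookup y∉ys y∈ys refl })
    where
    heads : ∀ ys → HeadsIn (_∈ ys) (concatMap (λ x → map (x ∷_) (words k xs)) ys)
    heads (z ∷ zs) = HeadsIn-++ (HeadsIn-map∷ _ (here refl)) (HeadsIn-mono there (heads zs))

perms-unique : ∀ n → Unique (perms n)
perms-unique n = filter⁺ (T? ∘ distinct) (words-unique n (range1 n) (range1-unique n))

-- The enumerations list exactly the good permutations

+0⇒≡ : ∀ {n k} → n + 0 ≡ k → n ≡ k
+0⇒≡ {n} e = trans (sym (+-identityʳ n)) e

+-suc⇒< : ∀ {n r k} → n + suc r ≡ k → n < k
+-suc⇒< {n} e = <-≤-trans (m<m+n n (s≤s z≤n)) (≤-reflexive e)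

+-suc-shift : ∀ {n r k} → n + suc r ≡ k → suc n + r ≡ k
+-suc-shift {n} {r} e = trans (sym (+-suc n r)) e

m+n≡m⇒n≡0 : ∀ {m n} → m + n ≡ m → n ≡ 0
m+n≡m⇒n≡0 {m} {n} e = +-cancelˡ-≡ m n 0 (trans e (sym (+-identityʳ m)))

-- Both directions carry the counts s, l, y of the values still to be placed;
-- they are determined by ns + s ≡ k, nl + l ≡ m and ny + y ≡ t + 1.
module MergeGenerator (k l₀ t : ℕ) where

  m : ℕ
  m = suc k + l₀

  HighAllowed⇒HighOK : ∀ {ph nl l} → HighAllowed l₀ ph l → nl + l ≡ m → (ph ≡ fresh → l ≡ l₀) → HighOK k m ph nl
  HighAllowed⇒HighOK {fresh}   l≡0        _ fr = trans (cong (suc k +_) (trans (sym (fr refl)) l≡0)) (+-identityʳ (suc k))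
  HighAllowed⇒HighOK {settled} {nl} (inj₁ refl) e _ = inj₁ (+-cancelʳ-≡ l₀ nl (suc k) e)
  HighAllowed⇒HighOK {settled} (inj₂ refl) e _ = inj₂ (+0⇒≡ e)

  HighOK⇒HighAllowed : ∀ {ph nl l} → HighOK k m ph nl → nl + l ≡ m → (ph ≡ fresh → l ≡ l₀) → HighAllowed l₀ ph l
  HighOK⇒HighAllowed {fresh}   m≡1+k      _ fr = trans (fr refl) (m+n≡m⇒n≡0 m≡1+k)
  HighOK⇒HighAllowed {settled} {l = l} (inj₁ refl) e _ = inj₁ (+-cancelˡ-≡ (suc k) l l₀ e)
  HighOK⇒HighAllowed {settled} (inj₂ refl) e _ = inj₂ (m+n≡m⇒n≡0 e)

  mutual
    ∈-merges⁻ : ∀ s l y {ns nl ny ph ℓ} → ℓ ∈ merges l₀ s l y ns nl ny ph →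
      ns + s ≡ k → nl + l ≡ m → ny + y ≡ suc t → (ph ≡ fresh → l ≡ l₀) → Merge k m t ns nl ny ph ℓ
    ∈-merges⁻ zero zero zero (here refl) eₛ eₗ eᵧ _ with +0⇒≡ eₛ | +0⇒≡ eₗ | +0⇒≡ eᵧ
    ... | refl | refl | refl = done
    ∈-merges⁻ (suc s) l y {ns} {nl} {ny} ℓ∈ eₛ eₗ eᵧ fr with ∈-++⁻ (map (ns ∷_) (merges l₀ s l y (suc ns) nl ny settled)) ℓ∈
    ... | inj₁ ℓ∈ˡ with ∈-map⁻ (ns ∷_) ℓ∈ˡ
    ...   | ℓ′ , ℓ′∈ , refl = low (+-suc⇒< eₛ) (∈-merges⁻ s l y ℓ′∈ (+-suc-shift eₛ) eₗ eᵧ λ ())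
    ∈-merges⁻ (suc s) l y ℓ∈ eₛ eₗ eᵧ fr | inj₂ ℓ∈ʳ = ∈-highFirst⁻ (suc s) l y ℓ∈ʳ eₛ eₗ eᵧ fr
    ∈-merges⁻ zero (suc l) y {ns} {nl} {ny} ℓ∈ eₛ eₗ eᵧ fr with +0⇒≡ eₛ | ∈-++⁻ (map (nl ∷_) (merges l₀ zero l y ns (suc nl) ny settled)) ℓ∈
    ... | refl | inj₁ ℓ∈ˡ with ∈-map⁻ (nl ∷_) ℓ∈ˡ
    ...   | ℓ′ , ℓ′∈ , refl = mid (+-suc⇒< eₗ) (∈-merges⁻ zero l y ℓ′∈ eₛ (+-suc-shift eₗ) eᵧ λ ())
    ∈-merges⁻ zero (suc l) y ℓ∈ eₛ eₗ eᵧ fr | refl | inj₂ ℓ∈ʳ = ∈-highFirst⁻ zero (suc l) y ℓ∈ʳ eₛ eₗ eᵧ fr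
    ∈-merges⁻ zero zero (suc y) ℓ∈ eₛ eₗ eᵧ fr = ∈-highFirst⁻ zero zero (suc y) ℓ∈ eₛ eₗ eᵧ fr

    ∈-highFirst⁻ : ∀ s l y {ns nl ny ph ℓ} → ℓ ∈ highFirst l₀ s l y ns nl ny ph →
      ns + s ≡ k → nl + l ≡ m → ny + y ≡ suc t → (ph ≡ fresh → l ≡ l₀) → Merge k m t ns nl ny ph ℓ
    ∈-highFirst⁻ s l (suc y) {ny = ny} {ph} ℓ∈ eₛ eₗ eᵧ fr with ∈-when⁻ {d = highAllowed? l₀ ph l} ℓ∈
    ... | allowed , ℓ∈′ with ∈-map⁻ (ny ∷_) ℓ∈′
    ...   | ℓ′ , ℓ′∈ , refl =
      high (≤-pred (+-suc⇒< eᵧ)) (HighAllowed⇒HighOK allowed eₗ fr) (∈-merges⁻ s l y ℓ′∈ eₛ eₗ (+-suc-shift eᵧ) λ ())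

  highFirst⊆merges : ∀ s l y {ns nl ny ph v} → v ∈ highFirst l₀ s l (suc y) ns nl ny ph → v ∈ merges l₀ s l (suc y) ns nl ny ph
  highFirst⊆merges (suc s) l       y v∈ = ∈-++⁺ʳ _ v∈
  highFirst⊆merges zero    (suc l) y v∈ = ∈-++⁺ʳ _ v∈
  highFirst⊆merges zero    zero    y v∈ = v∈

  ∈-merges⁺ : ∀ {ns nl ny ph ℓ} → Merge k m t ns nl ny ph ℓ → ∀ {s l y} →
    ns + s ≡ k → nl + l ≡ m → ny + y ≡ suc t → (ph ≡ fresh → l ≡ l₀) → ℓ ∈ merges l₀ s l y ns nl ny ph
  ∈-merges⁺ done eₛ eₗ eᵧ _ with m+n≡m⇒n≡0 eₛ | m+n≡m⇒n≡0 eₗ | m+n≡m⇒n≡0 eᵧ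
  ... | refl | refl | refl = here refl
  ∈-merges⁺ (low ns<k μ) {zero}  eₛ eₗ eᵧ _ = contradiction (+0⇒≡ eₛ) (<⇒≢ ns<k)
  ∈-merges⁺ (low ns<k μ) {suc s} eₛ eₗ eᵧ _ = ∈-++⁺ˡ (∈-map⁺ _ (∈-merges⁺ μ (+-suc-shift eₛ) eₗ eᵧ λ ()))
  ∈-merges⁺ (mid nl<m μ) {l = zero}  eₛ eₗ eᵧ _ = contradiction (+0⇒≡ eₗ) (<⇒≢ nl<m)
  ∈-merges⁺ (mid nl<m μ) {l = suc l} eₛ eₗ eᵧ _ with m+n≡m⇒n≡0 eₛ
  ... | refl = ∈-++⁺ˡ (∈-map⁺ _ (∈-merges⁺ μ eₛ (+-suc-shift eₗ) eᵧ λ ()))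
  ∈-merges⁺ (high ny≤t ok μ) {y = zero}  eₛ eₗ eᵧ _ = contradiction (+0⇒≡ eᵧ) (<⇒≢ (s≤s ny≤t))
  ∈-merges⁺ {ph = ph} (high ny≤t ok μ) {s} {l} {suc y} eₛ eₗ eᵧ fr =
    highFirst⊆merges s l y (∈-when⁺ (highAllowed? l₀ ph l) (HighOK⇒HighAllowed ok eₗ fr)
      (∈-map⁺ _ (∈-merges⁺ μ eₛ eₗ (+-suc-shift eᵧ) λ ())))

module TailGenerator (a k t : ℕ) where

  jumps-end : ∀ {h} → k + suc h ≡ t → suc k + 0 + h ≡ t
  jumps-end {h} e = trans (cong (λ x → suc x + h) (+-identityʳ k)) (trans (sym (+-suc k h)) e)

  jumps-next : ∀ {q y} → suc k + q + suc y ≡ t → suc k + suc q + y ≡ t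
  jumps-next {q} {y} e = trans (cong (_+ y) (+-suc (suc k) q)) (trans (sym (+-suc (suc k + q) y)) e)

  ∈-first-jump⁻ : ∀ s q y {ns ℓ} → ℓ ∈ map (suc k + q ∷_) (merges q s q y ns (suc k) (suc (suc k + q)) fresh) →
    ns + s ≡ k → suc k + q + y ≡ t → suc a < ns → Tail a k t ns ℓ
  ∈-first-jump⁻ s q y ℓ∈ eₛ e a+1<ns with ∈-map⁻ (suc k + q ∷_) ℓ∈
  ... | ℓ′ , ℓ′∈ , refl = jump a+1<ns (s≤s (m≤m+n k q)) (≤-trans (m≤m+n (suc k + q) y) (≤-reflexive e))
    (MergeGenerator.∈-merges⁻ k q t s q y ℓ′∈ eₛ refl (cong suc e) λ _ → refl)

  ∈-jumps⁻ : ∀ s q y {ns ℓ} → ℓ ∈ jumps s q y ns k → ns + s ≡ k → suc k + q + y ≡ t → suc a < ns → Tail a k t ns ℓ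
  ∈-jumps⁻ s q zero    ℓ∈ eₛ e a+1<ns = ∈-first-jump⁻ s q zero ℓ∈ eₛ e a+1<ns
  ∈-jumps⁻ s q (suc y) ℓ∈ eₛ e a+1<ns with ∈-++⁻ (map (suc k + q ∷_) (merges q s q (suc y) _ (suc k) (suc (suc k + q)) fresh)) ℓ∈
  ... | inj₁ ℓ∈ˡ = ∈-first-jump⁻ s q (suc y) ℓ∈ˡ eₛ e a+1<ns
  ... | inj₂ ℓ∈ʳ = ∈-jumps⁻ s (suc q) y ℓ∈ʳ eₛ (jumps-next e) a+1<ns

  ∈-tails⁻ : ∀ r h {ns ℓ} → ℓ ∈ tails r h ns k → ns + r ≡ k → k + h ≡ t → suc a < ns → Tail a k t ns ℓ
  ∈-tails⁻ zero    zero    (here refl) eᵣ eₕ _ with +0⇒≡ eᵣ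
  ... | refl = stop (+0⇒≡ eₕ)
  ∈-tails⁻ (suc r) zero    {ns} ℓ∈ eᵣ eₕ a+1<ns with ∈-map⁻ (ns ∷_) ℓ∈
  ... | ℓ′ , ℓ′∈ , refl = run (+-suc⇒< eᵣ) (∈-tails⁻ r zero ℓ′∈ (+-suc-shift eᵣ) eₕ (<-trans a+1<ns (n<1+n ns)))
  ∈-tails⁻ zero    (suc h) ℓ∈ eᵣ eₕ a+1<ns = ∈-jumps⁻ zero 0 h ℓ∈ eᵣ (jumps-end eₕ) a+1<ns
  ∈-tails⁻ (suc r) (suc h) {ns} ℓ∈ eᵣ eₕ a+1<ns with ∈-++⁻ (map (ns ∷_) (tails r (suc h) (suc ns) k)) ℓ∈
  ... | inj₂ ℓ∈ʳ = ∈-jumps⁻ (suc r) 0 h ℓ∈ʳ eᵣ (jumps-end eₕ) a+1<ns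
  ... | inj₁ ℓ∈ˡ with ∈-map⁻ (ns ∷_) ℓ∈ˡ
  ...   | ℓ′ , ℓ′∈ , refl = run (+-suc⇒< eᵣ) (∈-tails⁻ r (suc h) ℓ′∈ (+-suc-shift eᵣ) eₕ (<-trans a+1<ns (n<1+n ns)))

  ∈-jumps⁺ : ∀ s q y {ns m ℓ} → Merge k m t ns (suc k) (suc m) fresh ℓ →
    ns + s ≡ k → suc k + q ≤ m → m ≤ t → suc k + q + y ≡ t → m ∷ ℓ ∈ jumps s q y ns k
  ∈-jumps⁺ s q y {m = m} μ eₛ k+1+q≤m m≤t e with m≤n⇒m<n∨m≡n k+1+q≤m
  ∈-jumps⁺ s q zero    μ eₛ _ m≤t e | inj₂ refl = ∈-map⁺ _ (MergeGenerator.∈-merges⁺ k q t μ eₛ refl (cong suc e) λ _ → refl)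
  ∈-jumps⁺ s q (suc y) μ eₛ _ m≤t e | inj₂ refl = ∈-++⁺ˡ (∈-map⁺ _ (MergeGenerator.∈-merges⁺ k q t μ eₛ refl (cong suc e) λ _ → refl))
  ∈-jumps⁺ s q zero    μ eₛ _ m≤t e | inj₁ k+1+q<m =
    contradiction (≤-trans m≤t (≤-reflexive (sym (+0⇒≡ e)))) (<⇒≱ k+1+q<m)
  ∈-jumps⁺ s q (suc y) {m = m} μ eₛ _ m≤t e | inj₁ k+1+q<m =
    ∈-++⁺ʳ _ (∈-jumps⁺ s (suc q) y μ eₛ (subst (_≤ m) (sym (+-suc (suc k) q)) k+1+q<m) m≤t (jumps-next e))

  ∈-tails⁺ : ∀ {ns ℓ} → Tail a k t ns ℓ → ∀ {r h} → ns + r ≡ k → k + h ≡ t → ℓ ∈ tails r h ns k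
  ∈-tails⁺ (stop k≡t) eᵣ eₕ with m+n≡m⇒n≡0 eᵣ | m+n≡m⇒n≡0 (trans eₕ (sym k≡t))
  ... | refl | refl = here refl
  ∈-tails⁺ (run ns<k τ) {zero}          eᵣ eₕ = contradiction (+0⇒≡ eᵣ) (<⇒≢ ns<k)
  ∈-tails⁺ (run ns<k τ) {suc r} {zero}  eᵣ eₕ = ∈-map⁺ _ (∈-tails⁺ τ (+-suc-shift eᵣ) eₕ)
  ∈-tails⁺ (run ns<k τ) {suc r} {suc h} eᵣ eₕ = ∈-++⁺ˡ (∈-map⁺ _ (∈-tails⁺ τ (+-suc-shift eᵣ) eₕ))
  ∈-tails⁺ (jump _ k<m m≤t μ) {h = zero} eᵣ eₕ =
    contradiction (≤-trans m≤t (≤-reflexive (sym (+0⇒≡ eₕ)))) (<⇒≱ k<m)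
  ∈-tails⁺ (jump {m = m} _ k<m m≤t μ) {zero}  {suc h} eᵣ eₕ =
    ∈-jumps⁺ zero 0 h μ eᵣ (subst (_≤ m) (cong suc (sym (+-identityʳ k))) k<m) m≤t (jumps-end eₕ)
  ∈-tails⁺ (jump {m = m} _ k<m m≤t μ) {suc r} {suc h} eᵣ eₕ =
    ∈-++⁺ʳ _ (∈-jumps⁺ (suc r) 0 h μ eᵣ (subst (_≤ m) (cong suc (sym (+-identityʳ k))) k<m) m≤t (jumps-end eₕ))

startingAt-end : ∀ a i h → suc (suc a) + i + h ≡ a + suc (suc (i + h))
startingAt-end a i h = trans (cong (λ x → suc (suc x)) (+-assoc a i h))
                             (sym (trans (+-suc a (suc (i + h))) (cong suc (+-suc a (i + h)))))

∈-startingAt⁻ : ∀ a i h {π} → π ∈ startingAt a i h → IsPerm a (suc (suc (i + h))) π × Good π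
∈-startingAt⁻ a i h π∈ with ∈-map⁻ _ π∈
... | τ , τ∈ , refl = swap (Tail⇒Good∧IsPerm a N k (suc a ∷ τ) a+1<k k≤t (run a+1<k τ-tail))
  where
  N = suc (suc (i + h))
  k = suc (suc a) + i
  a+1<k = s≤s (s≤s (m≤m+n a i))
  k+h≡t = startingAt-end a i h
  k≤t = ≤-trans (m≤m+n k h) (≤-reflexive k+h≡t)
  τ-tail = TailGenerator.∈-tails⁻ a k (a + N) i h τ∈ refl k+h≡t (n<1+n (suc a))

∈-startingFrom⁻ : ∀ a i h {π} → π ∈ startingFrom a i h → IsPerm a (suc (suc (i + h))) π × Good π
∈-startingFrom⁻ a i zero    π∈ = ∈-startingAt⁻ a i zero π∈
∈-startingFrom⁻ a i (suc h) {π} π∈ with ∈-++⁻ (startingAt a i (suc h)) π∈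
... | inj₁ π∈ˡ = ∈-startingAt⁻ a i (suc h) π∈ˡ
... | inj₂ π∈ʳ = subst (λ N → IsPerm a N π × Good π) (cong (λ x → suc (suc x)) (sym (+-suc i h)))
                       (∈-startingFrom⁻ a (suc i) h π∈ʳ)

mutual
  ∈-goodPerms⁻ : ∀ a n {π} → π ∈ goodPerms a n → IsPerm a n π × Good π
  ∈-goodPerms⁻ a zero (here refl) =
    ([] , (λ ()) , λ a<z z≤a+0 → contradiction (≤-trans z≤a+0 (≤-reflexive (+-identityʳ a))) (<⇒≱ a<z)) , Good-[]
  ∈-goodPerms⁻ a (suc zero) π∈ = ∈-starting-a+1⁻ a zero π∈
  ∈-goodPerms⁻ a (suc (suc n)) π∈ with ∈-++⁻ (map (suc a ∷_) (goodPerms (suc a) (suc n))) π∈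
  ... | inj₁ π∈ˡ = ∈-starting-a+1⁻ a (suc n) π∈ˡ
  ... | inj₂ π∈ʳ = ∈-startingFrom⁻ a 0 n π∈ʳ

  ∈-starting-a+1⁻ : ∀ a n {π} → π ∈ map (suc a ∷_) (goodPerms (suc a) n) → IsPerm a (suc n) π × Good π
  ∈-starting-a+1⁻ a n π∈ with ∈-map⁻ _ π∈
  ... | σ , σ∈ , refl with ∈-goodPerms⁻ (suc a) n σ∈
  ...   | perm , good = IsPerm-∷-min⁺ perm , Good-∷-min⁺ perm good

startingAt⊆startingFrom : ∀ a i d h {π} → π ∈ startingAt a (i + d) h → π ∈ startingFrom a i (d + h)
startingAt⊆startingFrom a i zero zero    {π} π∈ = subst (λ j → π ∈ startingAt a j zero) (+-identityʳ i) π∈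
startingAt⊆startingFrom a i zero (suc h) {π} π∈ = ∈-++⁺ˡ (subst (λ j → π ∈ startingAt a j (suc h)) (+-identityʳ i) π∈)
startingAt⊆startingFrom a i (suc d) h    {π} π∈ =
  ∈-++⁺ʳ _ (startingAt⊆startingFrom a (suc i) d h (subst (λ j → π ∈ startingAt a j h) (+-suc i d) π∈))

starting-a+1⊆goodPerms : ∀ a n {π} → π ∈ map (suc a ∷_) (goodPerms (suc a) n) → π ∈ goodPerms a (suc n)
starting-a+1⊆goodPerms a zero    π∈ = π∈
starting-a+1⊆goodPerms a (suc n) π∈ = ∈-++⁺ˡ π∈

∈-startingFrom⁺ : ∀ a n {k σ} → IsPerm a (suc (suc n)) (k ∷ σ) → Good (k ∷ σ) → suc a < k → k ∷ σ ∈ startingFrom a 0 n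
∈-startingFrom⁺ a n {k} {σ} perm good a+1<k with m≤n⇒∃[o]m+o≡n a+1<k | m≤n⇒∃[o]m+o≡n k≤t
  where k≤t = proj₂ (proj₁ (proj₂ perm) (here refl))
... | i , refl | h , k+h≡t with Tail-head (Completeness.Good∧IsPerm⇒Tail a (suc (suc n)) k σ good perm a+1<k) a+1<k
  where open TailFacts a k (a + suc (suc n))
...   | τ , refl , τ-tail = subst (λ n′ → k ∷ σ ∈ startingFrom a 0 n′) i+h≡n
          (startingAt⊆startingFrom a 0 i h (∈-map⁺ _ (TailGenerator.∈-tails⁺ a k _ τ-tail refl k+h≡t)))
  where
  i+h≡n : i + h ≡ n
  i+h≡n = suc-injective (suc-injective (+-cancelˡ-≡ a _ _ (trans (sym (startingAt-end a i h)) k+h≡t)))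

∈-goodPerms-above⁺ : ∀ a n {k σ} → IsPerm a (suc n) (k ∷ σ) → Good (k ∷ σ) → suc a < k → k ∷ σ ∈ goodPerms a (suc n)
∈-goodPerms-above⁺ a zero     (_ , inRange , _) _ a+1<k =
  contradiction (≤-trans (proj₂ (inRange (here refl))) (≤-reflexive (+-comm a 1))) (<⇒≱ a+1<k)
∈-goodPerms-above⁺ a (suc n) perm good a+1<k = ∈-++⁺ʳ _ (∈-startingFrom⁺ a n perm good a+1<k)

∈-goodPerms⁺ : ∀ a n {π} → IsPerm a n π → Good π → π ∈ goodPerms a n
∈-goodPerms⁺ a zero    {[]}    _ _ = here refl
∈-goodPerms⁺ a zero    {x ∷ σ} (_ , inRange , _) _ =
  contradiction (≤-trans (proj₂ (inRange (here refl))) (≤-reflexive (+-identityʳ a))) (<⇒≱ (proj₁ (inRange (here refl))))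
∈-goodPerms⁺ a (suc n) {[]}    (_ , _ , covers) _ with covers (n<1+n a) (subst (suc a ≤_) (sym (+-suc a n)) (s≤s (m≤m+n a n)))
... | ()
∈-goodPerms⁺ a (suc n) {x ∷ σ} perm@(_ , inRange , _) good with x ≟ suc a
... | yes refl = starting-a+1⊆goodPerms a n (∈-map⁺ _ (∈-goodPerms⁺ (suc a) n (IsPerm-∷-min⁻ perm) (proj₁ (Good-∷⁻ good))))
... | no x≢a+1 = ∈-goodPerms-above⁺ a n perm good (≤∧≢⇒< (proj₁ (inRange (here refl))) (x≢a+1 ∘ sym))

choose : ℕ → ℕ → ℕ
choose n       zero    = 1
choose zero    (suc k) = 0
choose (suc n) (suc k) = choose n k + choose n (suc k)

choose≡C : ∀ n k → choose n k ≡ n C k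
choose≡C n       zero    = refl
choose≡C zero    (suc k) = refl
choose≡C (suc n) (suc k) = trans (cong₂ _+_ (choose≡C n k) (choose≡C n (suc k))) (nCk+nC[k+1]≡[n+1]C[k+1] n k)

choose-beyond : ∀ n k → n < k → choose n k ≡ 0
choose-beyond zero    (suc k) _         = refl
choose-beyond (suc n) (suc k) (s≤s n<k) = cong₂ _+_ (choose-beyond n k n<k) (choose-beyond n (suc k) (<-trans n<k (n<1+n k)))

choose-diagonal : ∀ n → choose n n ≡ 1
choose-diagonal zero    = refl
choose-diagonal (suc n) = cong₂ _+_ (choose-diagonal n) (choose-beyond n (suc n) (n<1+n n))

choose-1 : ∀ n → choose n 1 ≡ n
choose-1 zero    = refl
choose-1 (suc n) = cong suc (choose-1 n)

pascal : ∀ s y → choose (s + suc y) (suc y) + choose (suc s + y) y ≡ choose (suc s + suc y) (suc y)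
pascal s y = begin
  choose (s + suc y) (suc y) + choose (suc s + y) y     ≡⟨ cong (λ n → choose n (suc y) + choose (suc s + y) y) (+-suc s y) ⟩
  choose (suc s + y) (suc y) + choose (suc s + y) y     ≡⟨ +-comm (choose (suc s + y) (suc y)) _ ⟩
  choose (suc (suc s + y)) (suc y)                      ≡⟨ cong (λ n → choose n (suc y)) (sym (+-suc (suc s) y)) ⟩
  choose (suc s + suc y) (suc y)                        ∎

Σ≤ : ℕ → (ℕ → ℕ) → ℕ
Σ≤ zero    f = f 0
Σ≤ (suc h) f = Σ≤ h f + f (suc h)

Σ≤-unfoldˡ : ∀ h f → Σ≤ (suc h) f ≡ f 0 + Σ≤ h (λ j → f (suc j))
Σ≤-unfoldˡ zero    f = refl
Σ≤-unfoldˡ (suc h) f = trans (cong (_+ f (suc (suc h))) (Σ≤-unfoldˡ h f)) (+-assoc (f 0) _ _)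

Σ≤-+ : ∀ h f g → Σ≤ h (λ j → f j + g j) ≡ Σ≤ h f + Σ≤ h g
Σ≤-+ zero    f g = refl
Σ≤-+ (suc h) f g = trans (cong (_+ (f (suc h) + g (suc h))) (Σ≤-+ h f g)) (interchange (Σ≤ h f) (Σ≤ h g) (f (suc h)) (g (suc h)))

row-sum : ∀ n → Σ≤ n (choose n) ≡ 2 ^ n
row-sum zero    = refl
row-sum (suc n) = begin
  Σ≤ (suc n) (choose (suc n))                              ≡⟨ Σ≤-unfoldˡ n (choose (suc n)) ⟩
  1 + Σ≤ n (λ j → choose n j + choose n (suc j))           ≡⟨ cong (1 +_) (Σ≤-+ n (choose n) (λ j → choose n (suc j))) ⟩
  1 + (Σ≤ n (choose n) + Σ≤ n (λ j → choose n (suc j)))    ≡⟨ x∙yz≈y∙xz 1 (Σ≤ n (choose n)) _ ⟩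
  Σ≤ n (choose n) + (1 + Σ≤ n (λ j → choose n (suc j)))    ≡⟨ cong (Σ≤ n (choose n) +_) (sym (Σ≤-unfoldˡ n (choose n))) ⟩
  Σ≤ n (choose n) + (Σ≤ n (choose n) + choose n (suc n))   ≡⟨ cong (λ x → x + (x + choose n (suc n))) (row-sum n) ⟩
  2 ^ n + (2 ^ n + choose n (suc n))                       ≡⟨ cong (λ x → 2 ^ n + (2 ^ n + x)) (choose-beyond n (suc n) (n<1+n n)) ⟩
  2 ^ suc n                                                ∎

length-F≡length-goodPerms : ∀ n → length (F n) ≡ length (goodPerms 0 n)
length-F≡length-goodPerms n = unique∧set⇒length≡ (filter⁺ (T? ∘ good?) (perms-unique n)) (goodPerms-unique 0 n) to from
  where
  to : ∀ {π} → π ∈ F n → π ∈ goodPerms 0 n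
  to π∈ with ∈-filter⁻ (T? ∘ good?) {xs = perms n} π∈
  ... | π∈perms , good = ∈-goodPerms⁺ 0 n (∈-perms⁻ n π∈perms) (Equivalence.to (T-good?⇔Good _) good)
  from : ∀ {π} → π ∈ goodPerms 0 n → π ∈ F n
  from π∈ with ∈-goodPerms⁻ 0 n π∈
  ... | perm , good = ∈-filter⁺ (T? ∘ good?) {xs = perms n} (∈-perms⁺ n perm) (Equivalence.from (T-good?⇔Good _) good)

-- Counting

length-∷-++ : ∀ (x : ℕ) (A B : List (List ℕ)) → length (map (x ∷_) A ++ B) ≡ length A + length B
length-∷-++ x A B = trans (length-++ (map (x ∷_) A)) (cong (_+ length B) (length-map (x ∷_) A))

length-highFirst : ∀ l₀ s l y ns nl ny ph → HighAllowed l₀ ph l →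
  length (highFirst l₀ s l (suc y) ns nl ny ph) ≡ length (merges l₀ s l y ns nl (suc ny) settled)
length-highFirst l₀ s l y ns nl ny ph ok =
  trans (cong length (when-yes (highAllowed? l₀ ph l) ok)) (length-map (ny ∷_) (merges l₀ s l y ns nl (suc ny) settled))

length-highFirst-blocked : ∀ l₀ s l y ns nl ny ph → ¬ HighAllowed l₀ ph l → length (highFirst l₀ s l y ns nl ny ph) ≡ 0
length-highFirst-blocked l₀ s l zero    ns nl ny ph _  = refl
length-highFirst-blocked l₀ s l (suc y) ns nl ny ph ¬ok = cong length (when-no (highAllowed? l₀ ph l) ¬ok)

length-merges-low : ∀ l₀ s l y ns nl ny ph → length (merges l₀ (suc s) l y ns nl ny ph) ≡
  length (merges l₀ s l y (suc ns) nl ny settled) + length (highFirst l₀ (suc s) l y ns nl ny ph)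
length-merges-low l₀ s l y ns nl ny ph = length-∷-++ ns (merges l₀ s l y (suc ns) nl ny settled) (highFirst l₀ (suc s) l y ns nl ny ph)

length-merges-mid : ∀ l₀ l y ns nl ny ph → length (merges l₀ 0 (suc l) y ns nl ny ph) ≡
  length (merges l₀ 0 l y ns (suc nl) ny settled) + length (highFirst l₀ 0 (suc l) y ns nl ny ph)
length-merges-mid l₀ l y ns nl ny ph = length-∷-++ nl (merges l₀ 0 l y ns (suc nl) ny settled) (highFirst l₀ 0 (suc l) y ns nl ny ph)

no-mid-allowed : ∀ l₀ ph → HighAllowed l₀ ph 0
no-mid-allowed l₀ fresh   = refl
no-mid-allowed l₀ settled = inj₂ refl

length-merges-no-mid : ∀ l₀ s y ns nl ny ph → length (merges l₀ s 0 y ns nl ny ph) ≡ choose (s + y) y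
length-merges-no-mid l₀ zero    zero    ns nl ny ph = refl
length-merges-no-mid l₀ zero    (suc y) ns nl ny ph = begin
  length (highFirst l₀ 0 0 (suc y) ns nl ny ph)   ≡⟨ length-highFirst l₀ 0 0 y ns nl ny ph (no-mid-allowed l₀ ph) ⟩
  length (merges l₀ 0 0 y ns nl (suc ny) settled) ≡⟨ length-merges-no-mid l₀ 0 y ns nl (suc ny) settled ⟩
  choose y y                                      ≡⟨ trans (choose-diagonal y) (sym (choose-diagonal (suc y))) ⟩
  choose (suc y) (suc y)                          ∎
length-merges-no-mid l₀ (suc s) zero    ns nl ny ph =
  trans (length-merges-low l₀ s 0 0 ns nl ny ph) (cong (_+ 0) (length-merges-no-mid l₀ s 0 (suc ns) nl ny settled))
length-merges-no-mid l₀ (suc s) (suc y) ns nl ny ph = begin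
  length (merges l₀ (suc s) 0 (suc y) ns nl ny ph)
    ≡⟨ length-merges-low l₀ s 0 (suc y) ns nl ny ph ⟩
  length (merges l₀ s 0 (suc y) (suc ns) nl ny settled) + length (highFirst l₀ (suc s) 0 (suc y) ns nl ny ph)
    ≡⟨ cong₂ _+_ (length-merges-no-mid l₀ s (suc y) (suc ns) nl ny settled)
                 (trans (length-highFirst l₀ (suc s) 0 y ns nl ny ph (no-mid-allowed l₀ ph)) (length-merges-no-mid l₀ (suc s) y ns nl (suc ny) settled)) ⟩
  choose (s + suc y) (suc y) + choose (suc s + y) y
    ≡⟨ pascal s y ⟩
  choose (suc s + suc y) (suc y) ∎

-- Once the middle run has started, it must be completed before any high value.
length-merges-mid-started : ∀ l₀ l y ns nl ny → l < l₀ → length (merges l₀ 0 l y ns nl ny settled) ≡ 1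
length-merges-mid-started l₀ zero    y ns nl ny _ = trans (length-merges-no-mid l₀ 0 y ns nl ny settled) (choose-diagonal y)
length-merges-mid-started l₀ (suc l) y ns nl ny l<l₀ = begin
  length (merges l₀ 0 (suc l) y ns nl ny settled)
    ≡⟨ length-merges-mid l₀ l y ns nl ny settled ⟩
  length (merges l₀ 0 l y ns (suc nl) ny settled) + length (highFirst l₀ 0 (suc l) y ns nl ny settled)
    ≡⟨ cong₂ _+_ (length-merges-mid-started l₀ l y ns (suc nl) ny (<-trans (n<1+n l) l<l₀))
                 (length-highFirst-blocked l₀ 0 (suc l) y ns nl ny settled λ { (inj₁ refl) → <-irrefl refl l<l₀ ; (inj₂ ()) }) ⟩
  1 ∎

length-merges-mid-pending : ∀ q s y ns nl ny → length (merges (suc q) s (suc q) y ns nl ny settled) ≡ choose (suc s + y) y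
length-merges-mid-pending q zero    zero    ns nl ny =
  trans (length-merges-mid (suc q) q 0 ns nl ny settled) (cong (_+ 0) (length-merges-mid-started (suc q) q 0 ns (suc nl) ny (n<1+n q)))
length-merges-mid-pending q zero    (suc y) ns nl ny = begin
  length (merges (suc q) 0 (suc q) (suc y) ns nl ny settled)
    ≡⟨ length-merges-mid (suc q) q (suc y) ns nl ny settled ⟩
  length (merges (suc q) 0 q (suc y) ns (suc nl) ny settled) + length (highFirst (suc q) 0 (suc q) (suc y) ns nl ny settled)
    ≡⟨ cong₂ _+_ (length-merges-mid-started (suc q) q (suc y) ns (suc nl) ny (n<1+n q))
                 (trans (length-highFirst (suc q) 0 (suc q) y ns nl ny settled (inj₁ refl)) (length-merges-mid-pending q 0 y ns nl (suc ny))) ⟩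
  1 + choose (suc y) y
    ≡⟨ cong (_+ choose (suc y) y) (sym (choose-diagonal (suc y))) ⟩
  choose (suc y) (suc y) + choose (suc y) y
    ≡⟨ +-comm (choose (suc y) (suc y)) _ ⟩
  choose (suc (suc y)) (suc y) ∎
length-merges-mid-pending q (suc s) zero    ns nl ny =
  trans (length-merges-low (suc q) s (suc q) 0 ns nl ny settled) (cong (_+ 0) (length-merges-mid-pending q s 0 (suc ns) nl ny))
length-merges-mid-pending q (suc s) (suc y) ns nl ny = begin
  length (merges (suc q) (suc s) (suc q) (suc y) ns nl ny settled)
    ≡⟨ length-merges-low (suc q) s (suc q) (suc y) ns nl ny settled ⟩
  length (merges (suc q) s (suc q) (suc y) (suc ns) nl ny settled) + length (highFirst (suc q) (suc s) (suc q) (suc y) ns nl ny settled)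
    ≡⟨ cong₂ _+_ (length-merges-mid-pending q s (suc y) (suc ns) nl ny)
                 (trans (length-highFirst (suc q) (suc s) (suc q) y ns nl ny settled (inj₁ refl)) (length-merges-mid-pending q (suc s) y ns nl (suc ny))) ⟩
  choose (suc s + suc y) (suc y) + choose (suc (suc s) + y) y
    ≡⟨ pascal (suc s) y ⟩
  choose (suc (suc s) + suc y) (suc y) ∎

length-merges-fresh : ∀ q s y ns nl ny → length (merges q s q y ns nl ny fresh) ≡ choose (s + y) y
length-merges-fresh zero    s       y ns nl ny = length-merges-no-mid 0 s y ns nl ny fresh
length-merges-fresh (suc q) zero    y ns nl ny = begin
  length (merges (suc q) 0 (suc q) y ns nl ny fresh)
    ≡⟨ length-merges-mid (suc q) q y ns nl ny fresh ⟩
  length (merges (suc q) 0 q y ns (suc nl) ny settled) + length (highFirst (suc q) 0 (suc q) y ns nl ny fresh)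
    ≡⟨ cong₂ _+_ (length-merges-mid-started (suc q) q y ns (suc nl) ny (n<1+n q)) (length-highFirst-blocked (suc q) 0 (suc q) y ns nl ny fresh λ ()) ⟩
  1
    ≡⟨ sym (choose-diagonal y) ⟩
  choose y y ∎
length-merges-fresh (suc q) (suc s) y ns nl ny = begin
  length (merges (suc q) (suc s) (suc q) y ns nl ny fresh)
    ≡⟨ length-merges-low (suc q) s (suc q) y ns nl ny fresh ⟩
  length (merges (suc q) s (suc q) y (suc ns) nl ny settled) + length (highFirst (suc q) (suc s) (suc q) y ns nl ny fresh)
    ≡⟨ cong₂ _+_ (length-merges-mid-pending q s y (suc ns) nl ny) (length-highFirst-blocked (suc q) (suc s) (suc q) y ns nl ny fresh λ ()) ⟩
  choose (suc s + y) y + 0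
    ≡⟨ +-identityʳ _ ⟩
  choose (suc s + y) y ∎

length-jumps : ∀ s q y ns k → length (jumps s q y ns k) ≡ choose (suc s + y) y
length-jumps s q zero    ns k = trans (length-map _ (merges q s q 0 ns (suc k) _ fresh)) (length-merges-fresh q s 0 ns (suc k) _)
length-jumps s q (suc y) ns k = begin
  length (jumps s q (suc y) ns k)
    ≡⟨ length-∷-++ (suc k + q) (merges q s q (suc y) ns (suc k) _ fresh) (jumps s (suc q) y ns k) ⟩
  length (merges q s q (suc y) ns (suc k) _ fresh) + length (jumps s (suc q) y ns k)
    ≡⟨ cong₂ _+_ (length-merges-fresh q s (suc y) ns (suc k) _) (length-jumps s (suc q) y ns k) ⟩
  choose (s + suc y) (suc y) + choose (suc s + y) y
    ≡⟨ pascal s y ⟩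
  choose (suc s + suc y) (suc y) ∎

length-tails-no-high : ∀ r ns k → length (tails r 0 ns k) ≡ 1
length-tails-no-high zero    ns k = refl
length-tails-no-high (suc r) ns k = trans (length-map (ns ∷_) (tails r 0 (suc ns) k)) (length-tails-no-high r (suc ns) k)

length-tails : ∀ r h ns k → length (tails r (suc h) ns k) + 1 ≡ choose (suc (suc (r + h))) (suc h)
length-tails zero    h ns k = begin
  length (jumps 0 0 h ns k) + 1       ≡⟨ cong₂ _+_ (length-jumps 0 0 h ns k) (sym (choose-diagonal (suc h))) ⟩
  choose (suc h) h + choose (suc h) (suc h) ∎
length-tails (suc r) h ns k = begin
  length (tails (suc r) (suc h) ns k) + 1
    ≡⟨ cong (_+ 1) (length-∷-++ ns (tails r (suc h) (suc ns) k) (jumps (suc r) 0 h ns k)) ⟩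
  length (tails r (suc h) (suc ns) k) + length (jumps (suc r) 0 h ns k) + 1
    ≡⟨ trans (+-assoc (length (tails r (suc h) (suc ns) k)) _ 1) (cong (length (tails r (suc h) (suc ns) k) +_) (+-comm _ 1)) ⟩
  length (tails r (suc h) (suc ns) k) + (1 + length (jumps (suc r) 0 h ns k))
    ≡⟨ sym (+-assoc (length (tails r (suc h) (suc ns) k)) 1 _) ⟩
  length (tails r (suc h) (suc ns) k) + 1 + length (jumps (suc r) 0 h ns k)
    ≡⟨ cong₂ _+_ (length-tails r h (suc ns) k) (length-jumps (suc r) 0 h ns k) ⟩
  choose (suc (suc (r + h))) (suc h) + choose (suc (suc (r + h))) h
    ≡⟨ +-comm (choose (suc (suc (r + h))) (suc h)) _ ⟩
  choose (suc (suc (suc (r + h)))) (suc h) ∎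

length-startingFrom : ∀ a i h → length (startingFrom a i h) + h ≡ Σ≤ h (choose (suc (i + h)))
length-startingFrom a i zero    =
  trans (+-identityʳ _) (trans (length-map _ (tails i 0 (suc (suc a)) _)) (length-tails-no-high i (suc (suc a)) _))
length-startingFrom a i (suc h) = begin
  length (startingAt a i (suc h) ++ startingFrom a (suc i) h) + suc h
    ≡⟨ cong (_+ suc h) (trans (length-++ (startingAt a i (suc h))) (cong (_+ lenS) (length-map _ (tails i (suc h) (suc (suc a)) _)))) ⟩
  lenT + lenS + suc h
    ≡⟨ solve 3 (λ lenT lenS h → lenT :+ lenS :+ (con 1 :+ h) := (lenS :+ h) :+ (lenT :+ con 1)) refl lenT lenS h ⟩
  (lenS + h) + (lenT + 1)
    ≡⟨ cong₂ _+_ (length-startingFrom a (suc i) h) (length-tails i h (suc (suc a)) _) ⟩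
  Σ≤ h (choose (suc (suc i + h))) + choose (suc (suc (i + h))) (suc h)
    ≡⟨ cong (λ n → Σ≤ (suc h) (choose n)) (cong suc (sym (+-suc i h))) ⟩
  Σ≤ (suc h) (choose (suc (i + suc h))) ∎
  where
  lenT = length (tails i (suc h) (suc (suc a)) (suc (suc a) + i))
  lenS = length (startingFrom a (suc i) h)

length-goodPerms : ∀ a n → length (goodPerms a (suc n)) + choose (suc n) 2 + 1 ≡ 2 ^ suc n
length-goodPerms a zero    = refl
length-goodPerms a (suc n) = begin
  length (goodPerms a (suc (suc n))) + choose (suc (suc n)) 2 + 1
    ≡⟨ cong₂ (λ x y → x + y + 1) (length-∷-++ (suc a) (goodPerms (suc a) (suc n)) (startingFrom a 0 n))
                                 (cong (_+ B) (choose-1 (suc n))) ⟩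
  G + S + (suc n + B) + 1
    ≡⟨ solve 4 (λ G S n B → G :+ S :+ (con 1 :+ n :+ B) :+ con 1 := (G :+ B :+ con 1) :+ ((S :+ n) :+ con 1)) refl G S n B ⟩
  (G + B + 1) + ((S + n) + 1)
    ≡⟨ cong₂ _+_ (length-goodPerms (suc a) n) (cong₂ _+_ (length-startingFrom a 0 n) (sym (choose-diagonal (suc n)))) ⟩
  2 ^ suc n + Σ≤ (suc n) (choose (suc n))
    ≡⟨ cong (2 ^ suc n +_) (trans (row-sum (suc n)) (sym (+-identityʳ (2 ^ suc n)))) ⟩
  2 ^ suc (suc n) ∎
  where
  G = length (goodPerms (suc a) (suc n))
  S = length (startingFrom a 0 n)
  B = choose (suc n) 2

x+y+1∸y∸1≡x : ∀ x y → x + y + 1 ∸ y ∸ 1 ≡ x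
x+y+1∸y∸1≡x x y = begin
  x + y + 1 ∸ y ∸ 1     ≡⟨ cong (λ z → z ∸ y ∸ 1) (solve 2 (λ x y → x :+ y :+ con 1 := x :+ con 1 :+ y) refl x y) ⟩
  x + 1 + y ∸ y ∸ 1     ≡⟨ cong (_∸ 1) (m+n∸n≡m (x + 1) y) ⟩
  x + 1 ∸ 1             ≡⟨ m+n∸n≡m x 1 ⟩
  x                     ∎

theorem4p3 : (n : ℕ) → n ≥ 1 → length (F n) ≡ 2 ^ n ∸ n C 2 ∸ 1
theorem4p3 (suc n) _ = begin
  length (F (suc n))                                                        ≡⟨ length-F≡length-goodPerms (suc n) ⟩
  length (goodPerms 0 (suc n))                                              ≡⟨ sym (x+y+1∸y∸1≡x _ (choose (suc n) 2)) ⟩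
  length (goodPerms 0 (suc n)) + choose (suc n) 2 + 1 ∸ choose (suc n) 2 ∸ 1 ≡⟨ cong₂ (λ x y → x ∸ y ∸ 1) (length-goodPerms 0 n) (choose≡C (suc n) 2) ⟩
  2 ^ suc n ∸ suc n C 2 ∸ 1                                                 ∎
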